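{- Let $p$ be a prime and let $d$ be an integer with $(d,p)=1$. Define \[ S_3(d)=\mathop{\sum_{a=1}^{p-1}\sum_{b=1}^{p-1}\sum_{c=1}^{p-1}}_{abc\equiv d\pmod p} abc. \] Then \[ S_3(d)=\frac{p^5}{8}+O\bigl(p^{9/2}(\log p)^2\bigr), \] where the implied constant is absolute.
   Context: $f=O(g)$ means $|f|\le Cg$ for some constant $C>0$. -}

module Defs where

open import Data.Nat using (ℕ; suc; _+_; _*_; _∸_)
open import Data.Nat.Divisibility using (_∣?_)
open import Data.Integer as ℤ using (ℤ; +_; _-_; ∣_∣)
open import Data.List using (List; map; applyUpTo)
open import Data.Nat.ListAction using (sum)
open import Relation.Nullary.Decidable using (does)
open import Data.Bool using (if_then_else_)

range1 : ℕ → List ℕ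
range1 p = applyUpTo suc (p ∸ 1)

-- a ≡ d (mod p) for a : ℕ, d : ℤ, decided:  p ∣ |a - d|
-- (this is exactly the library's integer divisibility  + p ∣ (+ a - d))
-- S₃(d) = Σ_{1≤a,b,c≤p-1, abc ≡ d (mod p)} abc
S3 : ℕ → ℤ → ℕ
S3 p d = sum (map (λ a → sum (map (λ b → sum (map (λ c →
           if does (p ∣? ∣ + (a * b * c) - d ∣) then a * b * c else 0)
           (range1 p))) (range1 p))) (range1 p))

module Submission where

-- Put t x = 2x - p, so that 2a = p + t a. For fixed a, b exactly one c has abc ≡ d (mod p), and
-- t sums to 0 over 1 ≤ x ≤ p - 1, so expanding 8abc = (p + t a)(p + t b)(p + t c) gives
-- 8 S₃(d) = p³(p - 1)² + W with W = ∑_{abc ≡ d} t a t b t c, where p³(p - 1)² = p⁵ + O(p⁴).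
-- By Cauchy–Schwarz over c, W² ≤ ∑_c (t c)² ∑_c F(c)² with F(c) = ∑_{abc ≡ d} t a t b, and
-- ∑_c F(c)² = ∑_{a,a′} t a t a′ D(a/a′) for the Dedekind sums D(h) = ∑_x t x t (h x mod p).
-- Dedekind reciprocity, applied along the Euclidean algorithm for h/p, bounds |D(h)| by 4p²
-- times the sum of the partial quotients, and a partial quotient is at most p/(u r) where r is
-- the current remainder and u the denominator of the current convergent, so that u h ≡ ±r.
-- Each pair (u, r) arises for at most two h, whence ∑_h |D(h)| ≤ 8p² ∑_{u,r<p} p/(u r) = O(p³ log² p)
-- and W² = O(p⁹ log² p).

module S3-estimate where
  open import Data.Nat as ℕ using (ℕ; zero; suc; z≤n; s≤s; _%_; _/_; NonZero; _^_)
  import Data.Nat.Properties as ℕP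
  open import Data.Nat.DivMod
  import Data.Nat.Divisibility as ℕD
  open import Data.Nat.Coprimality as Cop using (Coprime; coprime-Bézout; coprime-divisor; prime⇒coprime)
  import Data.Nat.GCD as GCD
  open import Data.Nat.Primality using (Prime; euclidsLemma; prime⇒nonTrivial)
  open import Data.Nat.Logarithm using (⌊log₂_⌋; ⌊log₂⌋-mono-≤; ⌊log₂[2^n]⌋≡n)
  open import Data.Nat.ListAction using (sum)
  open import Data.Nat.ListAction.Properties using (sum-++)
  open import Data.Integer as ℤ using (ℤ; +_; -[1+_]; 0ℤ; 1ℤ; _+_; _*_; _-_; -_; ∣_∣; _≤_; +≤+)
  open import Data.Integer.Properties
  import Data.Integer.Divisibility as ℤU
  open import Data.Integer.Divisibility.Signed as ℤD using (_∣?_; ∣m∣n⇒∣m+n; ∣n⇒∣m*n; ∣⇒∣ᵤ; ∣ᵤ⇒∣; ∣m∣n⇒∣m-n)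
  open import Data.Integer.DivMod using (_%ℕ_; _/ℕ_; n%ℕd<d; a≡a%ℕn+[a/ℕn]*n)
  open import Data.Integer.Tactic.RingSolver using (solve-∀)
  import Data.Nat.Tactic.RingSolver as ℕSolver
  open import Data.Bool using (Bool; true; false; not; if_then_else_)
  open import Data.Bool.Properties using (not-involutive)
  open import Data.Product using (∃; _,_; proj₁; proj₂)
  open import Data.Sum using (inj₁; inj₂)
  open import Data.Empty using (⊥-elim)
  open import Data.List using ([]; _∷_; _++_; map; applyUpTo)
  open import Data.List.Properties using (applyUpTo-∷ʳ; map-++)
  open import Relation.Nullary using (Dec; yes; no; does; ¬_)
  open import Relation.Binary.PropositionalEquality
  open import Defs

  -- Finite sums

  -- ∑ n f = f 1 + ⋯ + f n; indices start at 1 to match the nonzero residues 1, …, p - 1.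
  ∑ : ℕ → (ℕ → ℤ) → ℤ
  ∑ zero    f = 0ℤ
  ∑ (suc n) f = ∑ n f + f (suc n)

  ∑-cong : ∀ n {f g : ℕ → ℤ} → (∀ i → 1 ℕ.≤ i → i ℕ.≤ n → f i ≡ g i) → ∑ n f ≡ ∑ n g
  ∑-cong zero    f≡g = refl
  ∑-cong (suc n) f≡g =
    cong₂ _+_ (∑-cong n (λ i 1≤i i≤n → f≡g i 1≤i (ℕP.m≤n⇒m≤1+n i≤n))) (f≡g (suc n) (s≤s z≤n) ℕP.≤-refl)

  ∑-mono-≤ : ∀ n {f g : ℕ → ℤ} → (∀ i → 1 ℕ.≤ i → i ℕ.≤ n → f i ≤ g i) → ∑ n f ≤ ∑ n g
  ∑-mono-≤ zero    f≤g = ≤-refl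
  ∑-mono-≤ (suc n) f≤g =
    +-mono-≤ (∑-mono-≤ n (λ i 1≤i i≤n → f≤g i 1≤i (ℕP.m≤n⇒m≤1+n i≤n))) (f≤g (suc n) (s≤s z≤n) ℕP.≤-refl)

  ∑-zero : ∀ n → ∑ n (λ _ → 0ℤ) ≡ 0ℤ
  ∑-zero zero    = refl
  ∑-zero (suc n) = cong (_+ 0ℤ) (∑-zero n)

  ∑-≡0 : ∀ n {f : ℕ → ℤ} → (∀ i → 1 ℕ.≤ i → i ℕ.≤ n → f i ≡ 0ℤ) → ∑ n f ≡ 0ℤ
  ∑-≡0 n f≡0 = trans (∑-cong n f≡0) (∑-zero n)

  ∑-nonNeg : ∀ n {f : ℕ → ℤ} → (∀ i → 1 ℕ.≤ i → i ℕ.≤ n → 0ℤ ≤ f i) → 0ℤ ≤ ∑ n f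
  ∑-nonNeg n 0≤f = subst (_≤ ∑ n _) (∑-zero n) (∑-mono-≤ n 0≤f)

  ∑-distrib-+ : ∀ n (f g : ℕ → ℤ) → ∑ n (λ i → f i + g i) ≡ ∑ n f + ∑ n g
  ∑-distrib-+ zero    f g = refl
  ∑-distrib-+ (suc n) f g =
    trans (cong (_+ (f (suc n) + g (suc n))) (∑-distrib-+ n f g)) (interchange (∑ n f) (∑ n g) _ _)
    where
    interchange : ∀ a b c d → (a + b) + (c + d) ≡ (a + c) + (b + d)
    interchange = solve-∀

  ∑-*ˡ : ∀ n c (f : ℕ → ℤ) → ∑ n (λ i → c * f i) ≡ c * ∑ n f
  ∑-*ˡ zero    c f = sym (*-zeroʳ c)
  ∑-*ˡ (suc n) c f = trans (cong (_+ c * f (suc n)) (∑-*ˡ n c f)) (sym (*-distribˡ-+ c (∑ n f) (f (suc n))))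

  ∑-*ʳ : ∀ n c (f : ℕ → ℤ) → ∑ n (λ i → f i * c) ≡ ∑ n f * c
  ∑-*ʳ n c f = trans (∑-cong n (λ i _ _ → *-comm (f i) c)) (trans (∑-*ˡ n c f) (*-comm c (∑ n f)))

  ∑-neg : ∀ n (f : ℕ → ℤ) → ∑ n (λ i → - f i) ≡ - ∑ n f
  ∑-neg zero    f = refl
  ∑-neg (suc n) f = trans (cong (_- f (suc n)) (∑-neg n f)) (sym (neg-distrib-+ (∑ n f) (f (suc n))))

  ∑-distrib-- : ∀ n (f g : ℕ → ℤ) → ∑ n (λ i → f i - g i) ≡ ∑ n f - ∑ n g
  ∑-distrib-- n f g = trans (∑-distrib-+ n f (λ i → - g i)) (cong (λ z → ∑ n f + z) (∑-neg n g))

  ∑-const : ∀ n c → ∑ n (λ _ → c) ≡ + n * c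
  ∑-const zero    c = sym (*-zeroˡ c)
  ∑-const (suc n) c = trans (cong (_+ c) (∑-const n c)) (step (+ n) c)
    where
    step : ∀ m c → m * c + c ≡ (1ℤ + m) * c
    step = solve-∀

  ∑-comm : ∀ n m (f : ℕ → ℕ → ℤ) → ∑ n (λ i → ∑ m (λ j → f i j)) ≡ ∑ m (λ j → ∑ n (λ i → f i j))
  ∑-comm zero    m f = sym (∑-zero m)
  ∑-comm (suc n) m f =
    trans (cong (_+ ∑ m (f (suc n))) (∑-comm n m f)) (sym (∑-distrib-+ m (λ j → ∑ n (λ i → f i j)) (f (suc n))))

  ∑-*-∑ : ∀ n m (f g : ℕ → ℤ) → ∑ n (λ i → ∑ m (λ j → f i * g j)) ≡ ∑ n f * ∑ m g
  ∑-*-∑ n m f g = trans (∑-cong n (λ i _ _ → ∑-*ˡ m (f i) g)) (∑-*ʳ n (∑ m g) f)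

  ∑-linear : ∀ n c₁ c₂ c₃ c₄ c (u₁ u₂ u₃ u₄ : ℕ → ℤ) →
    ∑ n (λ i → c₁ * u₁ i + c₂ * u₂ i + c₃ * u₃ i + c₄ * u₄ i + c) ≡ c₁ * ∑ n u₁ + c₂ * ∑ n u₂ + c₃ * ∑ n u₃ + c₄ * ∑ n u₄ + + n * c
  ∑-linear n c₁ c₂ c₃ c₄ c u₁ u₂ u₃ u₄ =
    trans (∑-distrib-+ n _ _) (cong₂ _+_ (trans (∑-distrib-+ n _ _) (cong₂ _+_ (trans (∑-distrib-+ n _ _) (cong₂ _+_
      (trans (∑-distrib-+ n _ _) (cong₂ _+_ (∑-*ˡ n c₁ u₁) (∑-*ˡ n c₂ u₂))) (∑-*ˡ n c₃ u₃))) (∑-*ˡ n c₄ u₄))) (∑-const n c))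

  ∑-split : ∀ a c (f : ℕ → ℤ) → ∑ (a ℕ.+ c) f ≡ ∑ a f + ∑ c (λ i → f (a ℕ.+ i))
  ∑-split a zero    f = trans (cong (λ z → ∑ z f) (ℕP.+-identityʳ a)) (sym (+-identityʳ (∑ a f)))
  ∑-split a (suc c) f = begin
    ∑ (a ℕ.+ suc c) f                                    ≡⟨ cong (λ z → ∑ z f) (ℕP.+-suc a c) ⟩
    ∑ (a ℕ.+ c) f + f (suc (a ℕ.+ c))                    ≡⟨ cong (_+ f (suc (a ℕ.+ c))) (∑-split a c f) ⟩
    ∑ a f + ∑ c (λ i → f (a ℕ.+ i)) + f (suc (a ℕ.+ c))  ≡⟨ +-assoc (∑ a f) _ _ ⟩
    ∑ a f + (∑ c (λ i → f (a ℕ.+ i)) + f (suc (a ℕ.+ c))) ≡⟨ cong (λ z → ∑ a f + (∑ c (λ i → f (a ℕ.+ i)) + f z)) (ℕP.+-suc a c) ⟨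
    ∑ a f + ∑ (suc c) (λ i → f (a ℕ.+ i))                ∎
    where open ≡-Reasoning

  term≤∑ : ∀ n j (f : ℕ → ℤ) → 1 ℕ.≤ j → j ℕ.≤ n → (∀ i → 0ℤ ≤ f i) → f j ≤ ∑ n f
  term≤∑ zero    zero    f () z≤n 0≤f
  term≤∑ (suc n) j f 1≤j j≤1+n 0≤f with ℕP.m≤n⇒m<n∨m≡n j≤1+n
  ... | inj₂ refl = subst (_≤ ∑ n f + f j) (+-identityˡ (f j)) (+-monoˡ-≤ (f j) (∑-nonNeg n (λ i _ _ → 0≤f i)))
  ... | inj₁ j<1+n = subst (_≤ ∑ n f + f (suc n)) (+-identityʳ (f j))
                       (+-mono-≤ (term≤∑ n j f 1≤j (ℕP.≤-pred j<1+n) 0≤f) (0≤f (suc n)))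

  ∑-mono-≤-range : ∀ m n (f : ℕ → ℤ) → m ℕ.≤ n → (∀ i → 0ℤ ≤ f i) → ∑ m f ≤ ∑ n f
  ∑-mono-≤-range m zero    f z≤n 0≤f = ≤-refl
  ∑-mono-≤-range m (suc n) f m≤1+n 0≤f with ℕP.m≤n⇒m<n∨m≡n m≤1+n
  ... | inj₂ refl  = ≤-refl
  ... | inj₁ m<1+n = subst (_≤ ∑ n f + f (suc n)) (+-identityʳ (∑ m f))
                       (+-mono-≤ (∑-mono-≤-range m n f (ℕP.≤-pred m<1+n) 0≤f) (0≤f (suc n)))

  sum-applyUpTo : ∀ n (f : ℕ → ℕ) → + sum (map f (applyUpTo suc n)) ≡ ∑ n (λ i → + f i)
  sum-applyUpTo zero    f = refl
  sum-applyUpTo (suc n) f = begin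
    + sum (map f (applyUpTo suc (suc n)))                    ≡⟨ cong (λ xs → + sum (map f xs)) (applyUpTo-∷ʳ suc n) ⟨
    + sum (map f (applyUpTo suc n ++ suc n ∷ []))            ≡⟨ cong (λ xs → + sum xs) (map-++ f (applyUpTo suc n) _) ⟩
    + sum (map f (applyUpTo suc n) ++ f (suc n) ∷ [])        ≡⟨ cong +_ (sum-++ (map f (applyUpTo suc n)) _) ⟩
    + (sum (map f (applyUpTo suc n)) ℕ.+ (f (suc n) ℕ.+ 0))  ≡⟨ pos-+ (sum (map f (applyUpTo suc n))) _ ⟩
    + sum (map f (applyUpTo suc n)) + + (f (suc n) ℕ.+ 0)    ≡⟨ cong₂ _+_ (sum-applyUpTo n f) (cong +_ (ℕP.+-identityʳ (f (suc n)))) ⟩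
    ∑ n (λ i → + f i) + + f (suc n)                          ∎
    where open ≡-Reasoning

  -- Indicators and counting

  -- Opaque, so that 𝟙 (p ∣? x) is never unfolded into the decision procedure during unification.
  opaque
    𝟙 : ∀ {A : Set} → Dec A → ℤ
    𝟙 (yes _) = 1ℤ
    𝟙 (no _)  = 0ℤ

    𝟙-yes : ∀ {A : Set} (a? : Dec A) → A → 𝟙 a? ≡ 1ℤ
    𝟙-yes (yes _) _ = refl
    𝟙-yes (no ¬a) a = ⊥-elim (¬a a)

    𝟙-no : ∀ {A : Set} (a? : Dec A) → ¬ A → 𝟙 a? ≡ 0ℤ
    𝟙-no (yes a) ¬a = ⊥-elim (¬a a)
    𝟙-no (no _)  _  = refl

    𝟙-nonNeg : ∀ {A : Set} (a? : Dec A) → 0ℤ ≤ 𝟙 a?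
    𝟙-nonNeg (yes _) = +≤+ z≤n
    𝟙-nonNeg (no _)  = ≤-refl

    𝟙-idem : ∀ {A : Set} (a? : Dec A) → 𝟙 a? * 𝟙 a? ≡ 𝟙 a?
    𝟙-idem (yes _) = refl
    𝟙-idem (no _)  = refl

    if-does≡𝟙* : ∀ {A : Set} (a? : Dec A) x → + (if does a? then x else 0) ≡ 𝟙 a? * + x
    if-does≡𝟙* (yes _) x = sym (*-identityˡ (+ x))
    if-does≡𝟙* (no _)  x = refl

  𝟙-cong : ∀ {A B : Set} (a? : Dec A) (b? : Dec B) → (A → B) → (B → A) → 𝟙 a? ≡ 𝟙 b?
  𝟙-cong a? b? a→b b→a with a?
  ... | yes a = trans (𝟙-yes (yes a) a) (sym (𝟙-yes b? (a→b a)))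
  ... | no ¬a = trans (𝟙-no (no ¬a) ¬a) (sym (𝟙-no b? (λ b → ¬a (b→a b))))

  𝟙-yes-* : ∀ {A : Set} (a? : Dec A) → A → ∀ x → 𝟙 a? * x ≡ x
  𝟙-yes-* a? a x = trans (cong (_* x) (𝟙-yes a? a)) (*-identityˡ x)

  𝟙-no-* : ∀ {A : Set} (a? : Dec A) → ¬ A → ∀ x → 𝟙 a? * x ≡ 0ℤ
  𝟙-no-* a? ¬a x = trans (cong (_* x) (𝟙-no a? ¬a)) (*-zeroˡ x)

  ∑-𝟙≟ : ∀ n j (f : ℕ → ℤ) → 1 ℕ.≤ j → j ℕ.≤ n → ∑ n (λ i → 𝟙 (i ℕ.≟ j) * f i) ≡ f j
  ∑-𝟙≟ zero    zero    f () z≤n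
  ∑-𝟙≟ (suc n) j f 1≤j j≤1+n with ℕP.m≤n⇒m<n∨m≡n j≤1+n
  ... | inj₂ refl = trans (cong₂ _+_ (∑-≡0 n off-diagonal) (𝟙-yes-* (j ℕ.≟ j) refl (f j))) (+-identityˡ (f j))
    where
    off-diagonal : ∀ i → 1 ℕ.≤ i → i ℕ.≤ n → 𝟙 (i ℕ.≟ j) * f i ≡ 0ℤ
    off-diagonal i _ i≤n = 𝟙-no-* (i ℕ.≟ j) (λ { refl → ℕP.<-irrefl refl (s≤s i≤n) }) (f i)
  ... | inj₁ j<1+n = trans (cong₂ _+_ (∑-𝟙≟ n j f 1≤j (ℕP.≤-pred j<1+n)) (𝟙-no-* (suc n ℕ.≟ j) (λ { refl → ℕP.<-irrefl refl j<1+n }) _))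
                         (+-identityʳ (f j))

  ∑-𝟙-unique : ∀ n {P : ℕ → Set} (P? : ∀ i → Dec (P i)) →
               (∀ i j → i ℕ.≤ n → j ℕ.≤ n → P i → P j → i ≡ j) → ∑ n (λ i → 𝟙 (P? i)) ≤ 1ℤ
  ∑-𝟙-unique zero    P? unique = +≤+ z≤n
  ∑-𝟙-unique (suc n) {P} P? unique with P? (suc n)
  ... | yes P[1+n] = ≤-reflexive (cong₂ _+_ (∑-≡0 n (λ i _ i≤n → 𝟙-no (P? i) (i≢1+n i i≤n))) (𝟙-yes (yes P[1+n]) P[1+n]))
    where
    i≢1+n : ∀ i → i ℕ.≤ n → ¬ P i
    i≢1+n i i≤n Pi = ℕP.<-irrefl (unique i (suc n) (ℕP.m≤n⇒m≤1+n i≤n) ℕP.≤-refl Pi P[1+n]) (s≤s i≤n)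
  ... | no ¬P[1+n] = subst (_≤ 1ℤ) (sym (trans (cong (λ z → ∑ n (λ i → 𝟙 (P? i)) + z) (𝟙-no (no ¬P[1+n]) ¬P[1+n])) (+-identityʳ _)))
                       (∑-𝟙-unique n P? (λ i j i≤n j≤n → unique i j (ℕP.m≤n⇒m≤1+n i≤n) (ℕP.m≤n⇒m≤1+n j≤n)))

  ∑-𝟙≤? : ∀ n m (h : ℕ → ℤ) → ∑ n (λ i → 𝟙 (i ℕ.≤? m) * h i) ≡ ∑ (n ℕ.⊓ m) h
  ∑-𝟙≤? zero    m h = refl
  ∑-𝟙≤? (suc n) m h with suc n ℕ.≤? m
  ... | yes 1+n≤m = begin
    ∑ n (λ i → 𝟙 (i ℕ.≤? m) * h i) + 𝟙 (yes 1+n≤m) * h (suc n) ≡⟨ cong₂ _+_ (∑-𝟙≤? n m h) (𝟙-yes-* (yes 1+n≤m) 1+n≤m (h (suc n))) ⟩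
    ∑ (n ℕ.⊓ m) h + h (suc n)                                  ≡⟨ cong (λ k → ∑ k h + h (suc n)) (ℕP.m≤n⇒m⊓n≡m (ℕP.<⇒≤ 1+n≤m)) ⟩
    ∑ (suc n) h                                                ≡⟨ cong (λ k → ∑ k h) (ℕP.m≤n⇒m⊓n≡m 1+n≤m) ⟨
    ∑ (suc n ℕ.⊓ m) h                                          ∎
    where open ≡-Reasoning
  ... | no 1+n≰m = begin
    ∑ n (λ i → 𝟙 (i ℕ.≤? m) * h i) + 𝟙 (no 1+n≰m) * h (suc n)  ≡⟨ cong₂ _+_ (∑-𝟙≤? n m h) (𝟙-no-* (no 1+n≰m) 1+n≰m (h (suc n))) ⟩
    ∑ (n ℕ.⊓ m) h + 0ℤ                                         ≡⟨ +-identityʳ _ ⟩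
    ∑ (n ℕ.⊓ m) h                                              ≡⟨ cong (λ k → ∑ k h) (ℕP.m≥n⇒m⊓n≡n (ℕP.≤-pred (ℕP.≰⇒> 1+n≰m))) ⟩
    ∑ m h                                                      ≡⟨ cong (λ k → ∑ k h) (ℕP.m≥n⇒m⊓n≡n (ℕP.<⇒≤ (ℕP.≰⇒> 1+n≰m))) ⟨
    ∑ (suc n ℕ.⊓ m) h                                          ∎
    where open ≡-Reasoning

  ∑-𝟙<? : ∀ n m (h : ℕ → ℤ) → ∑ n (λ i → 𝟙 (m ℕ.<? i) * h i) ≡ ∑ n h - ∑ (n ℕ.⊓ m) h
  ∑-𝟙<? n m h = begin
    ∑ n (λ i → 𝟙 (m ℕ.<? i) * h i)                     ≡⟨ ∑-cong n (λ i _ _ → complement i) ⟩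
    ∑ n (λ i → h i - 𝟙 (i ℕ.≤? m) * h i)               ≡⟨ ∑-distrib-- n h _ ⟩
    ∑ n h - ∑ n (λ i → 𝟙 (i ℕ.≤? m) * h i)             ≡⟨ cong (λ z → ∑ n h - z) (∑-𝟙≤? n m h) ⟩
    ∑ n h - ∑ (n ℕ.⊓ m) h                              ∎
    where
    open ≡-Reasoning
    complement : ∀ i → 𝟙 (m ℕ.<? i) * h i ≡ h i - 𝟙 (i ℕ.≤? m) * h i
    complement i with i ℕ.≤? m
    ... | yes i≤m = trans (𝟙-no-* (m ℕ.<? i) (ℕP.≤⇒≯ i≤m) (h i))
                          (sym (trans (cong (λ z → h i - z) (𝟙-yes-* (yes i≤m) i≤m (h i))) (+-inverseʳ (h i))))
    ... | no i≰m  = trans (𝟙-yes-* (m ℕ.<? i) (ℕP.≰⇒> i≰m) (h i))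
                          (sym (trans (cong (λ z → h i - z) (𝟙-no-* (no i≰m) i≰m (h i))) (+-identityʳ (h i))))

  i*i≡∣i∣*∣i∣ : ∀ i → i * i ≡ + (∣ i ∣ ℕ.* ∣ i ∣)
  i*i≡∣i∣*∣i∣ (+ n)    = sym (pos-* n n)
  i*i≡∣i∣*∣i∣ -[1+ n ] = +◃n≡+n _

  i*i≥0 : ∀ i → 0ℤ ≤ i * i
  i*i≥0 i = subst (0ℤ ≤_) (sym (i*i≡∣i∣*∣i∣ i)) (+≤+ z≤n)

  *-nonNeg : ∀ i j → 0ℤ ≤ i → 0ℤ ≤ j → 0ℤ ≤ i * j
  *-nonNeg i j 0≤i 0≤j = subst (_≤ i * j) (*-zeroˡ j) (*-monoʳ-≤-nonNeg j {{ℤ.nonNegative 0≤j}} 0≤i)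

  pos-+* : ∀ a b c → + (a ℕ.+ b ℕ.* c) ≡ + a + + b * + c
  pos-+* a b c = trans (pos-+ a (b ℕ.* c)) (cong (λ z → + a + z) (pos-* b c))

  *-mono-≤-nonNeg : ∀ {i i′ j j′} → 0ℤ ≤ i → 0ℤ ≤ j → i ≤ i′ → j ≤ j′ → i * j ≤ i′ * j′
  *-mono-≤-nonNeg {i} {i′} {j} {j′} 0≤i 0≤j i≤i′ j≤j′ =
    ≤-trans (*-monoʳ-≤-nonNeg j {{ℤ.nonNegative 0≤j}} i≤i′) (*-monoˡ-≤-nonNeg i′ {{ℤ.nonNegative (≤-trans 0≤i i≤i′)}} j≤j′)

  cauchy-schwarz : ∀ n (f g : ℕ → ℤ) →
    ∑ n (λ i → f i * g i) * ∑ n (λ i → f i * g i) ≤ ∑ n (λ i → f i * f i) * ∑ n (λ i → g i * g i)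
  cauchy-schwarz n f g = *-cancelˡ-≤-pos (M * M) (A * B) (+ 2) (0≤i-j⇒j≤i (subst (0ℤ ≤_) lagrange 0≤T))
    where
    A B M T : ℤ
    A = ∑ n (λ i → f i * f i)
    B = ∑ n (λ i → g i * g i)
    M = ∑ n (λ i → f i * g i)
    T = ∑ n (λ i → ∑ n (λ j → (f i * g j - f j * g i) * (f i * g j - f j * g i)))
    0≤T : 0ℤ ≤ T
    0≤T = ∑-nonNeg n (λ i _ _ → ∑-nonNeg n (λ j _ _ → i*i≥0 (f i * g j - f j * g i)))
    expand : ∀ a b c d → (a * d - c * b) * (a * d - c * b) ≡ (a * a) * (d * d) + ((b * b) * (c * c) - + 2 * (a * b) * (c * d))
    expand = solve-∀
    collect : ∀ a b m → a * b + (b * a - + 2 * m * m) ≡ + 2 * (a * b) - + 2 * (m * m)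
    collect = solve-∀
    lagrange : T ≡ + 2 * (A * B) - + 2 * (M * M)
    lagrange = begin
      T
        ≡⟨ ∑-cong n (λ i _ _ → ∑-cong n (λ j _ _ → expand (f i) (g i) (f j) (g j))) ⟩
      ∑ n (λ i → ∑ n (λ j → (f i * f i) * (g j * g j) + ((g i * g i) * (f j * f j) - + 2 * (f i * g i) * (f j * g j))))
        ≡⟨ trans (∑-cong n (λ i _ _ → ∑-distrib-+ n _ _)) (∑-distrib-+ n _ _) ⟩
      ∑ n (λ i → ∑ n (λ j → (f i * f i) * (g j * g j))) + ∑ n (λ i → ∑ n (λ j → (g i * g i) * (f j * f j) - + 2 * (f i * g i) * (f j * g j)))
        ≡⟨ cong₂ _+_ (∑-*-∑ n n _ _) (trans (∑-cong n (λ i _ _ → ∑-distrib-- n _ _)) (∑-distrib-- n _ _)) ⟩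
      A * B + (∑ n (λ i → ∑ n (λ j → (g i * g i) * (f j * f j))) - ∑ n (λ i → ∑ n (λ j → + 2 * (f i * g i) * (f j * g j))))
        ≡⟨ cong (λ z → A * B + z) (cong₂ _-_ (∑-*-∑ n n _ _) (trans (∑-*-∑ n n _ _) (cong (_* M) (∑-*ˡ n (+ 2) _)))) ⟩
      A * B + (B * A - + 2 * M * M)
        ≡⟨ collect A B M ⟩
      + 2 * (A * B) - + 2 * (M * M) ∎
      where open ≡-Reasoning

  ∑-id : ∀ n → + 2 * ∑ n (λ x → + x) ≡ + n * (+ n + 1ℤ)
  ∑-id zero    = refl
  ∑-id (suc n) = trans (*-distribˡ-+ (+ 2) (∑ n (λ x → + x)) _) (trans (cong (_+ + 2 * (1ℤ + + n)) (∑-id n)) (step (+ n)))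
    where
    step : ∀ m → m * (m + 1ℤ) + + 2 * (1ℤ + m) ≡ (1ℤ + m) * ((1ℤ + m) + 1ℤ)
    step = solve-∀

  ∑-square : ∀ n → + 6 * ∑ n (λ x → + x * + x) ≡ + n * (+ n + 1ℤ) * (+ 2 * + n + 1ℤ)
  ∑-square zero    = refl
  ∑-square (suc n) = trans (*-distribˡ-+ (+ 6) (∑ n (λ x → + x * + x)) _) (trans (cong (_+ + 6 * ((1ℤ + + n) * (1ℤ + + n))) (∑-square n)) (step (+ n)))
    where
    step : ∀ m → m * (m + 1ℤ) * (+ 2 * m + 1ℤ) + + 6 * ((1ℤ + m) * (1ℤ + m)) ≡ (1ℤ + m) * ((1ℤ + m) + 1ℤ) * (+ 2 * (1ℤ + m) + 1ℤ)
    step = solve-∀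

  -- Residues

  [m*[n%o]]%o≡[m*n]%o : ∀ m n o .{{_ : NonZero o}} → (m ℕ.* (n % o)) % o ≡ (m ℕ.* n) % o
  [m*[n%o]]%o≡[m*n]%o m n o = begin
    (m ℕ.* (n % o)) % o              ≡⟨ %-distribˡ-* m (n % o) o ⟩
    ((m % o) ℕ.* (n % o % o)) % o    ≡⟨ cong (λ z → ((m % o) ℕ.* z) % o) (m%n%n≡m%n n o) ⟩
    ((m % o) ℕ.* (n % o)) % o        ≡⟨ %-distribˡ-* m n o ⟨
    (m ℕ.* n) % o                    ∎
    where open ≡-Reasoning

  [[m%o]*n]%o≡[m*n]%o : ∀ m n o .{{_ : NonZero o}} → ((m % o) ℕ.* n) % o ≡ (m ℕ.* n) % o
  [[m%o]*n]%o≡[m*n]%o m n o =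
    trans (cong (_% o) (ℕP.*-comm (m % o) n)) (trans ([m*[n%o]]%o≡[m*n]%o n m o) (cong (_% o) (ℕP.*-comm n m)))

  *%-cancel : ∀ a b x k .{{_ : NonZero k}} → (a ℕ.* b) % k ≡ 1 → x ℕ.< k → (a ℕ.* ((b ℕ.* x) % k)) % k ≡ x
  *%-cancel a b x k ab≡1 x<k = begin
    (a ℕ.* ((b ℕ.* x) % k)) % k      ≡⟨ [m*[n%o]]%o≡[m*n]%o a (b ℕ.* x) k ⟩
    (a ℕ.* (b ℕ.* x)) % k            ≡⟨ cong (_% k) (ℕP.*-assoc a b x) ⟨
    ((a ℕ.* b) ℕ.* x) % k            ≡⟨ [[m%o]*n]%o≡[m*n]%o (a ℕ.* b) x k ⟨
    (((a ℕ.* b) % k) ℕ.* x) % k      ≡⟨ cong (λ z → (z ℕ.* x) % k) ab≡1 ⟩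
    (1 ℕ.* x) % k                    ≡⟨ cong (_% k) (ℕP.*-identityˡ x) ⟩
    x % k                            ≡⟨ m<n⇒m%n≡m x<k ⟩
    x                                ∎
    where open ≡-Reasoning

  %-inverse : ∀ h m → Coprime h (2 ℕ.+ m) → ∃ λ h' → (h ℕ.* h') % (2 ℕ.+ m) ≡ 1
  %-inverse h m c with coprime-Bézout c
  ... | GCD.Bézout.+- x y eq = x , (begin
    (h ℕ.* x) % k            ≡⟨ cong (_% k) (ℕP.*-comm h x) ⟩
    (x ℕ.* h) % k            ≡⟨ cong (_% k) eq ⟨
    (1 ℕ.+ y ℕ.* k) % k      ≡⟨ [m+kn]%n≡m%n 1 y k ⟩
    1                        ∎)
    where
    open ≡-Reasoning
    k : ℕ
    k = 2 ℕ.+ m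
  ... | GCD.Bézout.-+ x y eq = (1 ℕ.+ m) ℕ.* x , (begin
    (h ℕ.* ((1 ℕ.+ m) ℕ.* x)) % k                 ≡⟨ [m+n]%n≡m%n (h ℕ.* ((1 ℕ.+ m) ℕ.* x)) k ⟨
    (h ℕ.* ((1 ℕ.+ m) ℕ.* x) ℕ.+ k) % k           ≡⟨ cong (_% k) (rearrange h x m) ⟩
    (1 ℕ.+ (1 ℕ.+ m) ℕ.* (1 ℕ.+ x ℕ.* h)) % k     ≡⟨ cong (λ z → (1 ℕ.+ (1 ℕ.+ m) ℕ.* z) % k) eq ⟩
    (1 ℕ.+ (1 ℕ.+ m) ℕ.* (y ℕ.* k)) % k           ≡⟨ cong (λ z → (1 ℕ.+ z) % k) (ℕP.*-assoc (1 ℕ.+ m) y k) ⟨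
    (1 ℕ.+ (1 ℕ.+ m) ℕ.* y ℕ.* k) % k             ≡⟨ [m+kn]%n≡m%n 1 ((1 ℕ.+ m) ℕ.* y) k ⟩
    1                                             ∎)
    where
    open ≡-Reasoning
    k : ℕ
    k = 2 ℕ.+ m
    rearrange : ∀ h x m → h ℕ.* ((1 ℕ.+ m) ℕ.* x) ℕ.+ (2 ℕ.+ m) ≡ 1 ℕ.+ (1 ℕ.+ m) ℕ.* (1 ℕ.+ x ℕ.* h)
    rearrange = ℕSolver.solve-∀

  [m*n]%o≡1⇒coprime : ∀ m n o .{{_ : NonZero o}} → (m ℕ.* n) % o ≡ 1 → Coprime o n
  [m*n]%o≡1⇒coprime m n o mn≡1 {d} (d∣o , d∣n) = ℕD.∣1⇒≡1 (ℕD.∣m+n∣m⇒∣n d∣[mn/o]*o+1 (ℕD.∣n⇒∣m*n (m ℕ.* n / o) d∣o))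
    where
    mn≡[mn/o]*o+1 : m ℕ.* n ≡ (m ℕ.* n / o) ℕ.* o ℕ.+ 1
    mn≡[mn/o]*o+1 = trans (m≡m%n+[m/n]*n (m ℕ.* n) o) (trans (cong (ℕ._+ (m ℕ.* n / o) ℕ.* o) mn≡1) (ℕP.+-comm 1 _))
    d∣[mn/o]*o+1 : d ℕD.∣ (m ℕ.* n / o) ℕ.* o ℕ.+ 1
    d∣[mn/o]*o+1 = subst (d ℕD.∣_) mn≡[mn/o]*o+1 (ℕD.∣n⇒∣m*n m d∣n)

  [m*x]%k≢0 : ∀ m k .{{_ : NonZero k}} → Coprime k m → ∀ x → 1 ℕ.≤ x → x ℕ.< k → 1 ℕ.≤ (m ℕ.* x) % k
  [m*x]%k≢0 m k c x 1≤x x<k with (m ℕ.* x) % k in eq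
  ... | suc _ = s≤s z≤n
  ... | zero  = ⊥-elim (ℕP.<-irrefl refl (ℕP.<-≤-trans x<k (ℕD.∣⇒≤ {{ℕ.>-nonZero 1≤x}} k∣x)))
    where
    k∣x : k ℕD.∣ x
    k∣x = coprime-divisor c (ℕD.m%n≡0⇒n∣m (m ℕ.* x) k eq)

  -- Both sides equal the double sum against the Kronecker delta of y ≡ h x, which is that of x ≡ h⁻¹ y.
  ∑-*%-permute : ∀ m h → Coprime h (suc m) → (f : ℕ → ℤ) → ∑ m (λ x → f ((h ℕ.* x) % suc m)) ≡ ∑ m f
  ∑-*%-permute zero    h c f = refl
  ∑-*%-permute (suc m) h c f = begin
    ∑ n (λ x → f (φ x))                          ≡⟨ ∑-cong n (λ x 1≤x x≤n → sym (∑-𝟙≟ n (φ x) f (φ≥1 x 1≤x x≤n) (φ≤n x))) ⟩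
    ∑ n (λ x → ∑ n (λ y → 𝟙 (y ℕ.≟ φ x) * f y))  ≡⟨ ∑-comm n n _ ⟩
    ∑ n (λ y → ∑ n (λ x → 𝟙 (y ℕ.≟ φ x) * f y))  ≡⟨ ∑-cong n (λ y _ y≤n → ∑-cong n (λ x _ x≤n → cong (_* f y) (same-delta x y x≤n y≤n))) ⟩
    ∑ n (λ y → ∑ n (λ x → 𝟙 (x ℕ.≟ ψ y) * f y))  ≡⟨ ∑-cong n (λ y 1≤y y≤n → ∑-𝟙≟ n (ψ y) (λ _ → f y) (ψ≥1 y 1≤y y≤n) (ψ≤n y)) ⟩
    ∑ n f                                        ∎
    where
    open ≡-Reasoning
    n k : ℕ
    n = suc m
    k = 2 ℕ.+ m
    h⁻¹ : ℕ
    h⁻¹ = proj₁ (%-inverse h m c)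
    hh⁻¹≡1 : (h ℕ.* h⁻¹) % k ≡ 1
    hh⁻¹≡1 = proj₂ (%-inverse h m c)
    h⁻¹h≡1 : (h⁻¹ ℕ.* h) % k ≡ 1
    h⁻¹h≡1 = trans (cong (_% k) (ℕP.*-comm h⁻¹ h)) hh⁻¹≡1
    φ ψ : ℕ → ℕ
    φ x = (h ℕ.* x) % k
    ψ y = (h⁻¹ ℕ.* y) % k
    φ≥1 : ∀ x → 1 ℕ.≤ x → x ℕ.≤ n → 1 ℕ.≤ φ x
    φ≥1 x 1≤x x≤n = [m*x]%k≢0 h k (Cop.sym c) x 1≤x (s≤s x≤n)
    ψ≥1 : ∀ y → 1 ℕ.≤ y → y ℕ.≤ n → 1 ℕ.≤ ψ y
    ψ≥1 y 1≤y y≤n = [m*x]%k≢0 h⁻¹ k ([m*n]%o≡1⇒coprime h h⁻¹ k hh⁻¹≡1) y 1≤y (s≤s y≤n)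
    φ≤n : ∀ x → φ x ℕ.≤ n
    φ≤n x = ℕP.≤-pred (m%n<n (h ℕ.* x) k)
    ψ≤n : ∀ y → ψ y ℕ.≤ n
    ψ≤n y = ℕP.≤-pred (m%n<n (h⁻¹ ℕ.* y) k)
    same-delta : ∀ x y → x ℕ.≤ n → y ℕ.≤ n → 𝟙 (y ℕ.≟ φ x) ≡ 𝟙 (x ℕ.≟ ψ y)
    same-delta x y x≤n y≤n = 𝟙-cong (y ℕ.≟ φ x) (x ℕ.≟ ψ y)
      (λ y≡φx → sym (trans (cong ψ y≡φx) (*%-cancel h⁻¹ h x k h⁻¹h≡1 (s≤s x≤n))))
      (λ x≡ψy → sym (trans (cong φ x≡ψy) (*%-cancel h h⁻¹ y k hh⁻¹≡1 (s≤s y≤n))))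

  module PrimeModulus (m : ℕ) (pr : Prime (2 ℕ.+ m)) where
    n p : ℕ
    n = 1 ℕ.+ m
    p = 2 ℕ.+ m
    P : ℤ
    P = + p

    coprime : ∀ h → 1 ℕ.≤ h → h ℕ.≤ n → Coprime h p
    coprime h 1≤h h≤n = Cop.sym (prime⇒coprime pr {{ℕ.>-nonZero 1≤h}} (s≤s h≤n))

    %p≤n : ∀ x → x % p ℕ.≤ n
    %p≤n x = ℕP.≤-pred (m%n<n x p)

    [h*x]%p≥1 : ∀ h x → 1 ℕ.≤ h → h ℕ.≤ n → 1 ℕ.≤ x → x ℕ.≤ n → 1 ℕ.≤ (h ℕ.* x) % p
    [h*x]%p≥1 h x 1≤h h≤n 1≤x x≤n = [m*x]%k≢0 h p (Cop.sym (coprime h 1≤h h≤n)) x 1≤x (s≤s x≤n)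

    ∑-permute : ∀ h → 1 ℕ.≤ h → h ℕ.≤ n → (f : ℕ → ℤ) → ∑ n (λ x → f ((h ℕ.* x) % p)) ≡ ∑ n f
    ∑-permute h 1≤h h≤n = ∑-*%-permute n h (coprime h 1≤h h≤n)

    p∣u[x-y]⇒x≡y : ∀ u x y → 1 ℕ.≤ u → u ℕ.≤ n → x ℕ.≤ n → y ℕ.≤ n → P ℤD.∣ + u * (+ x - + y) → x ≡ y
    p∣u[x-y]⇒x≡y u x y 1≤u u≤n x≤n y≤n p∣ with euclidsLemma u ∣ + x - + y ∣ pr (subst (p ℕD.∣_) (abs-* (+ u) (+ x - + y)) (∣⇒∣ᵤ p∣))
    ... | inj₁ p∣u = ⊥-elim (ℕD.>⇒∤ {{ℕ.>-nonZero 1≤u}} (s≤s u≤n) p∣u)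
    ... | inj₂ p∣x-y with ∣ + x - + y ∣ in eq
    ...   | zero  = +-injective (i-j≡0⇒i≡j (+ x) (+ y) (∣i∣≡0⇒i≡0 eq))
    ...   | suc k = ⊥-elim (ℕD.>⇒∤ (s≤s ∣x-y∣≤n) p∣x-y)
      where
      ∣x-y∣≤n : suc k ℕ.≤ n
      ∣x-y∣≤n = subst (ℕ._≤ n) eq (ℕP.≤-trans (subst (ℕ._≤ x ℕ.⊔ y) (cong ∣_∣ (sym (m-n≡m⊖n x y))) (∣m⊝n∣≤m⊔n x y)) (ℕP.⊔-lub x≤n y≤n))

    p∣x-[x%p] : ∀ x → P ℤD.∣ (+ x - + (x % p))
    p∣x-[x%p] x = subst (P ℤD.∣_) (sym x-[x%p]≡[x/p]*p) (∣n⇒∣m*n (+ (x / p)) ℤD.∣-refl)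
      where
      cancel : ∀ r q → (r + q) - r ≡ q
      cancel = solve-∀
      x-[x%p]≡[x/p]*p : + x - + (x % p) ≡ + (x / p) * P
      x-[x%p]≡[x/p]*p = trans (cong (λ z → + z - + (x % p)) (m≡m%n+[m/n]*n x p))
        (trans (cong (_- + (x % p)) (pos-+ (x % p) (x / p ℕ.* p))) (trans (cancel (+ (x % p)) _) (pos-* (x / p) p)))

    %p-cong⇒∣ : ∀ x y → x % p ≡ y % p → P ℤD.∣ (+ x - + y)
    %p-cong⇒∣ x y x≡y = subst (P ℤD.∣_) regroup (∣m∣n⇒∣m-n (p∣x-[x%p] x) (p∣x-[x%p] y))
      where
      telescope : ∀ x y r → (x - r) - (y - r) ≡ x - y
      telescope = solve-∀
      regroup : (+ x - + (x % p)) - (+ y - + (y % p)) ≡ + x - + y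
      regroup = trans (cong (λ z → (+ x - + (x % p)) - (+ y - + z)) (sym x≡y)) (telescope (+ x) (+ y) (+ (x % p)))

    ∣⇒%p-cong : ∀ x y → P ℤD.∣ (+ x - + y) → x % p ≡ y % p
    ∣⇒%p-cong x y p∣x-y = p∣u[x-y]⇒x≡y 1 (x % p) (y % p) (s≤s z≤n) (s≤s z≤n) (%p≤n x) (%p≤n y)
      (subst (P ℤD.∣_) (regroup (+ x) (+ y) (+ (x % p)) (+ (y % p))) (∣m∣n⇒∣m+n (∣m∣n⇒∣m-n p∣x-y (p∣x-[x%p] x)) (p∣x-[x%p] y)))
      where
      regroup : ∀ x y r s → ((x - y) - (x - r)) + (y - s) ≡ + 1 * (r - s)
      regroup = solve-∀

    *-cancelʳ-%p : ∀ h h′ c → 1 ℕ.≤ c → c ℕ.≤ n → h ℕ.≤ n → h′ ℕ.≤ n → (h ℕ.* c) % p ≡ (h′ ℕ.* c) % p → h ≡ h′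
    *-cancelʳ-%p h h′ c 1≤c c≤n h≤n h′≤n hc≡h′c =
      p∣u[x-y]⇒x≡y c h h′ 1≤c c≤n h≤n h′≤n (subst (P ℤD.∣_) factor (%p-cong⇒∣ (h ℕ.* c) (h′ ℕ.* c) hc≡h′c))
      where
      commute : ∀ h h′ c → h * c - h′ * c ≡ c * (h - h′)
      commute = solve-∀
      factor : + (h ℕ.* c) - + (h′ ℕ.* c) ≡ + c * (+ h - + h′)
      factor = trans (cong₂ _-_ (pos-* h c) (pos-* h′ c)) (commute (+ h) (+ h′) (+ c))

    opaque
      -- Junk value 0 outside 1 ≤ x ≤ n.
      inverse : ℕ → ℕ
      inverse x with 1 ℕ.≤? x | x ℕ.≤? n
      ... | yes 1≤x | yes x≤n = proj₁ (%-inverse x m (coprime x 1≤x x≤n)) % p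
      ... | _       | _       = 0

      inverse-*-%p : ∀ x → 1 ℕ.≤ x → x ℕ.≤ n → (inverse x ℕ.* x) % p ≡ 1
      inverse-*-%p x 1≤x x≤n with 1 ℕ.≤? x | x ℕ.≤? n
      ... | no 1≰x   | _        = ⊥-elim (1≰x 1≤x)
      ... | yes _    | no x≰n   = ⊥-elim (x≰n x≤n)
      ... | yes 1≤x′ | yes x≤n′ with %-inverse x m (coprime x 1≤x′ x≤n′)
      ...   | y , xy≡1 = trans ([[m%o]*n]%o≡[m*n]%o y x p) (trans (cong (_% p) (ℕP.*-comm y x)) xy≡1)

      inverse≤n : ∀ x → inverse x ℕ.≤ n
      inverse≤n x with 1 ℕ.≤? x | x ℕ.≤? n
      ... | yes 1≤x | yes x≤n = %p≤n (proj₁ (%-inverse x m (coprime x 1≤x x≤n)))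
      ... | yes _   | no _    = z≤n
      ... | no _    | _       = z≤n

    inverse≥1 : ∀ x → 1 ℕ.≤ x → x ℕ.≤ n → 1 ℕ.≤ inverse x
    inverse≥1 x 1≤x x≤n with inverse x in eq
    ... | suc _ = s≤s z≤n
    ... | zero  = ⊥-elim (0≢1 (trans (cong (λ z → (z ℕ.* x) % p) (sym eq)) (inverse-*-%p x 1≤x x≤n)))
      where
      0≢1 : 0 ≢ 1
      0≢1 ()

    ∑-𝟙[hc≡t] : ∀ h t → 1 ℕ.≤ h → h ℕ.≤ n → 1 ℕ.≤ t → t ℕ.≤ n → ∑ n (λ c → 𝟙 ((h ℕ.* c) % p ℕ.≟ t)) ≡ 1ℤ
    ∑-𝟙[hc≡t] h t 1≤h h≤n 1≤t t≤n = trans (∑-permute h 1≤h h≤n (λ y → 𝟙 (y ℕ.≟ t)))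
      (trans (∑-cong n (λ y _ _ → sym (*-identityʳ (𝟙 (y ℕ.≟ t))))) (∑-𝟙≟ n t (λ _ → 1ℤ) 1≤t t≤n))

    ∑-𝟙[hc≡t]𝟙[h′c≡t] : ∀ h h′ t → 1 ℕ.≤ h → h ℕ.≤ n → h′ ℕ.≤ n → 1 ℕ.≤ t → t ℕ.≤ n →
      ∑ n (λ c → 𝟙 ((h ℕ.* c) % p ℕ.≟ t) * 𝟙 ((h′ ℕ.* c) % p ℕ.≟ t)) ≡ 𝟙 (h ℕ.≟ h′)
    ∑-𝟙[hc≡t]𝟙[h′c≡t] h h′ t 1≤h h≤n h′≤n 1≤t t≤n with h ℕ.≟ h′
    ... | yes refl = trans (∑-cong n (λ c _ _ → 𝟙-idem ((h ℕ.* c) % p ℕ.≟ t)))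
                       (trans (∑-𝟙[hc≡t] h t 1≤h h≤n 1≤t t≤n) (sym (𝟙-yes (yes refl) refl)))
    ... | no h≢h′ = trans (∑-≡0 n disjoint) (sym (𝟙-no (no h≢h′) h≢h′))
      where
      disjoint : ∀ c → 1 ℕ.≤ c → c ℕ.≤ n → 𝟙 ((h ℕ.* c) % p ℕ.≟ t) * 𝟙 ((h′ ℕ.* c) % p ℕ.≟ t) ≡ 0ℤ
      disjoint c 1≤c c≤n with (h ℕ.* c) % p ℕ.≟ t | (h′ ℕ.* c) % p ℕ.≟ t
      ... | yes hc≡t | yes h′c≡t = ⊥-elim (h≢h′ (*-cancelʳ-%p h h′ c 1≤c c≤n h≤n h′≤n (trans hc≡t (sym h′c≡t))))
      ... | yes hc≡t | no h′c≢t  = trans (*-comm (𝟙 (yes hc≡t)) _) (𝟙-no-* (no h′c≢t) h′c≢t (𝟙 (yes hc≡t)))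
      ... | no hc≢t  | h′c≟t     = 𝟙-no-* (no hc≢t) hc≢t (𝟙 h′c≟t)

    ∑-select : ∀ u t (g : ℕ → ℤ) → 1 ℕ.≤ u → u ℕ.≤ n → 1 ℕ.≤ t → t ℕ.≤ n →
      ∑ n (λ y → g y * 𝟙 ((u ℕ.* y) % p ℕ.≟ t)) ≡ g ((inverse u ℕ.* t) % p)
    ∑-select u t g 1≤u u≤n 1≤t t≤n = begin
      ∑ n (λ y → g y * 𝟙 ((u ℕ.* y) % p ℕ.≟ t))
        ≡⟨ ∑-cong n (λ y _ y≤n → trans (*-comm (g y) _) (cong (λ z → 𝟙 ((u ℕ.* y) % p ℕ.≟ t) * g z) (sym (*%-cancel (inverse u) u y p (inverse-*-%p u 1≤u u≤n) (s≤s y≤n))))) ⟩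
      ∑ n (λ y → G ((u ℕ.* y) % p))
        ≡⟨ ∑-permute u 1≤u u≤n G ⟩
      ∑ n G
        ≡⟨ ∑-𝟙≟ n t (λ z → g ((inverse u ℕ.* z) % p)) 1≤t t≤n ⟩
      g ((inverse u ℕ.* t) % p) ∎
      where
      open ≡-Reasoning
      G : ℕ → ℤ
      G z = 𝟙 (z ℕ.≟ t) * g ((inverse u ℕ.* z) % p)

  -- Dedekind sums and reciprocity

  τ : ℕ → ℕ → ℤ
  τ k x = + 2 * + x - + k

  -- With k = m + 1, D h m = 4 k² s(h, k) for the classical Dedekind sum s(h, k) = ∑ ((x/k)) ((hx/k)).
  D : ℕ → ℕ → ℤ
  D h m = ∑ m (λ x → τ (suc m) x * τ (suc m) ((h ℕ.* x) % suc m))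

  module FloorSums (a b : ℕ) (cop : Coprime (suc a) (suc b)) where
    h k : ℕ
    h = suc a
    k = suc b
    H K : ℤ
    H = + h
    K = + k
    r f g : ℕ → ℕ
    r x = (h ℕ.* x) % k
    f x = (h ℕ.* x) / k
    g y = (k ℕ.* y) / h

    Σx Σx² Σxf Σf Σf² Σg Σg² : ℤ
    Σx  = ∑ b (λ x → + x)
    Σx² = ∑ b (λ x → + x * + x)
    Σxf = ∑ b (λ x → + x * + f x)
    Σf  = ∑ b (λ x → + f x)
    Σf² = ∑ b (λ x → + f x * + f x)
    Σg  = ∑ a (λ y → + g y)
    Σg² = ∑ a (λ y → + g y * + g y)

    hx≡r+fk : ∀ x → h ℕ.* x ≡ r x ℕ.+ f x ℕ.* k
    hx≡r+fk x = m≡m%n+[m/n]*n (h ℕ.* x) k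

    r≡hx-fk : ∀ x → + r x ≡ H * + x - + f x * K
    r≡hx-fk x = begin
      + r x                            ≡⟨ add-sub (+ r x) (+ f x * K) ⟨
      (+ r x + + f x * K) - + f x * K  ≡⟨ cong (_- + f x * K) (trans (pos-+ (r x) (f x ℕ.* k)) (cong (λ z → + r x + z) (pos-* (f x) k))) ⟨
      + (r x ℕ.+ f x ℕ.* k) - + f x * K ≡⟨ cong (λ z → + z - + f x * K) (hx≡r+fk x) ⟨
      + (h ℕ.* x) - + f x * K          ≡⟨ cong (_- + f x * K) (pos-* h x) ⟩
      H * + x - + f x * K              ∎
      where
      open ≡-Reasoning
      add-sub : ∀ u v → (u + v) - v ≡ u
      add-sub = solve-∀

    r≥1 : ∀ x → 1 ℕ.≤ x → x ℕ.≤ b → 1 ℕ.≤ r x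
    r≥1 x 1≤x x≤b = [m*x]%k≢0 h k (Cop.sym cop) x 1≤x (s≤s x≤b)

    f≤a : ∀ x → x ℕ.≤ b → f x ℕ.≤ a
    f≤a x x≤b = ℕP.≤-pred (m<n*o⇒m/o<n {h ℕ.* x} {h} {k} (ℕP.*-monoʳ-< h (s≤s x≤b)))

    g≤b : ∀ y → y ℕ.≤ a → g y ℕ.≤ b
    g≤b y y≤a = ℕP.≤-pred (m<n*o⇒m/o<n {k ℕ.* y} {k} {h} (ℕP.*-monoʳ-< k (s≤s y≤a)))

    D-expand : D h b ≡ (+ 4 * H) * Σx² + (- (+ 4 * K)) * Σxf + (- (+ 2 * K * (1ℤ + H))) * Σx + (+ 2 * K * K) * Σf + + b * (K * K)
    D-expand = trans (∑-cong b (λ x _ _ → trans (cong (λ z → τ k x * (+ 2 * z - K)) (r≡hx-fk x)) (expand H K (+ x) (+ f x))))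
                     (∑-linear b (+ 4 * H) (- (+ 4 * K)) (- (+ 2 * K * (1ℤ + H))) (+ 2 * K * K) (K * K) (λ x → + x * + x) (λ x → + x * + f x) (λ x → + x) (λ x → + f x))
      where
      expand : ∀ H K x f → (+ 2 * x - K) * (+ 2 * (H * x - f * K) - K) ≡
               (+ 4 * H) * (x * x) + (- (+ 4 * K)) * (x * f) + (- (+ 2 * K * (1ℤ + H))) * x + (+ 2 * K * K) * f + K * K
      expand = solve-∀

    2Σf≡ab : + 2 * Σf ≡ + a * + b
    2Σf≡ab = *-cancelˡ-≡ K (+ 2 * Σf) (+ a * + b) (begin
      K * (+ 2 * Σf)                                   ≡⟨ rearrange H K Σx Σf ⟩
      (H - 1ℤ) * (+ 2 * Σx) - + 2 * (H * Σx - K * Σf - Σx) ≡⟨ cong₂ (λ u v → (H - 1ℤ) * u - + 2 * v) (∑-id b) Σr-Σx≡0 ⟩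
      (H - 1ℤ) * (+ b * (+ b + 1ℤ)) - + 2 * 0ℤ         ≡⟨ collect (+ a) (+ b) ⟩
      K * (+ a * + b)                                  ∎)
      where
      open ≡-Reasoning
      Σr≡ : ∑ b (λ x → + r x) ≡ H * Σx - K * Σf
      Σr≡ = trans (∑-cong b (λ x _ _ → r≡hx-fk x)) (trans (∑-distrib-- b _ _)
              (cong₂ _-_ (∑-*ˡ b H (λ x → + x)) (trans (∑-*ʳ b K (λ x → + f x)) (*-comm Σf K))))
      Σr-Σx≡0 : H * Σx - K * Σf - Σx ≡ 0ℤ
      Σr-Σx≡0 = trans (cong (_- Σx) (trans (sym Σr≡) (∑-*%-permute b h cop (λ z → + z)))) (+-inverseʳ Σx)
      rearrange : ∀ H K s f → K * (+ 2 * f) ≡ (H - 1ℤ) * (+ 2 * s) - + 2 * (H * s - K * f - s)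
      rearrange = solve-∀
      collect : ∀ a b → ((1ℤ + a) - 1ℤ) * (b * (b + 1ℤ)) - + 2 * 0ℤ ≡ (1ℤ + b) * (a * b)
      collect = solve-∀

    Σr²≡Σx² : (H * H) * Σx² + (- (+ 2 * H * K)) * Σxf + (K * K) * Σf² ≡ Σx²
    Σr²≡Σx² = begin
      (H * H) * Σx² + (- (+ 2 * H * K)) * Σxf + (K * K) * Σf²
        ≡⟨ drop-zeros ((H * H) * Σx²) ((- (+ 2 * H * K)) * Σxf) ((K * K) * Σf²) (∑ b (λ _ → 0ℤ)) (+ b) ⟨
      (H * H) * Σx² + (- (+ 2 * H * K)) * Σxf + (K * K) * Σf² + 0ℤ * ∑ b (λ _ → 0ℤ) + + b * 0ℤ
        ≡⟨ ∑-linear b (H * H) (- (+ 2 * H * K)) (K * K) 0ℤ 0ℤ (λ x → + x * + x) (λ x → + x * + f x) (λ x → + f x * + f x) (λ _ → 0ℤ) ⟨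
      ∑ b (λ x → (H * H) * (+ x * + x) + (- (+ 2 * H * K)) * (+ x * + f x) + (K * K) * (+ f x * + f x) + 0ℤ * 0ℤ + 0ℤ)
        ≡⟨ ∑-cong b (λ x _ _ → trans (cong (λ z → z * z) (r≡hx-fk x)) (square H K (+ x) (+ f x))) ⟨
      ∑ b (λ x → + r x * + r x)
        ≡⟨ ∑-*%-permute b h cop (λ z → + z * + z) ⟩
      Σx² ∎
      where
      open ≡-Reasoning
      drop-zeros : ∀ u v w z n → u + v + w + 0ℤ * z + n * 0ℤ ≡ u + v + w
      drop-zeros = solve-∀
      square : ∀ H K x f → (H * x - f * K) * (H * x - f * K) ≡ (H * H) * (x * x) + (- (+ 2 * H * K)) * (x * f) + (K * K) * (f * f) + 0ℤ * 0ℤ + 0ℤ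
      square = solve-∀

    below⇒≤f : ∀ x y → k ℕ.* y ℕ.< h ℕ.* x → y ℕ.≤ f x
    below⇒≤f x y ky<hx with y ℕ.≤? f x
    ... | yes y≤f = y≤f
    ... | no  y≰f = ⊥-elim (ℕP.<-irrefl refl (ℕP.<-trans ky<hx (ℕP.<-≤-trans hx<k+fk k+fk≤ky)))
      where
      hx<k+fk : h ℕ.* x ℕ.< k ℕ.+ f x ℕ.* k
      hx<k+fk = subst (ℕ._< k ℕ.+ f x ℕ.* k) (sym (hx≡r+fk x)) (ℕP.+-monoˡ-< (f x ℕ.* k) (m%n<n (h ℕ.* x) k))
      k+fk≤ky : k ℕ.+ f x ℕ.* k ℕ.≤ k ℕ.* y
      k+fk≤ky = subst (ℕ._≤ k ℕ.* y) (ℕP.*-comm k (suc (f x))) (ℕP.*-monoʳ-≤ k (ℕP.≰⇒> y≰f))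

    -- Strictness uses r x ≥ 1, that is, that k never divides h x.
    ≤f⇒below : ∀ x y → 1 ℕ.≤ x → x ℕ.≤ b → y ℕ.≤ f x → k ℕ.* y ℕ.< h ℕ.* x
    ≤f⇒below x y 1≤x x≤b y≤f = ℕP.≤-<-trans (ℕP.≤-trans (ℕP.*-monoʳ-≤ k y≤f) (ℕP.≤-reflexive (ℕP.*-comm k (f x))))
      (subst (f x ℕ.* k ℕ.<_) (sym (hx≡r+fk x)) (ℕP.+-monoˡ-≤ (f x ℕ.* k) (r≥1 x 1≤x x≤b)))

    below⇒g< : ∀ x y → k ℕ.* y ℕ.< h ℕ.* x → g y ℕ.< x
    below⇒g< x y ky<hx with g y ℕ.<? x
    ... | yes g<x = g<x
    ... | no  g≮x = ⊥-elim (ℕP.<-irrefl refl (ℕP.<-≤-trans ky<hx hx≤ky))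
      where
      hx≤ky : h ℕ.* x ℕ.≤ k ℕ.* y
      hx≤ky = ℕP.≤-trans (ℕP.*-monoʳ-≤ h (ℕP.≮⇒≥ g≮x)) (ℕP.≤-trans (ℕP.≤-reflexive (ℕP.*-comm h (g y)))
                (subst (g y ℕ.* h ℕ.≤_) (sym (m≡m%n+[m/n]*n (k ℕ.* y) h)) (ℕP.m≤n+m (g y ℕ.* h) _)))

    g<⇒below : ∀ x y → g y ℕ.< x → k ℕ.* y ℕ.< h ℕ.* x
    g<⇒below x y g<x = subst (ℕ._< h ℕ.* x) (sym (m≡m%n+[m/n]*n (k ℕ.* y) h))
      (ℕP.<-≤-trans (ℕP.+-monoˡ-< (g y ℕ.* h) (m%n<n (k ℕ.* y) h)) (ℕP.≤-trans (ℕP.*-monoˡ-≤ h g<x) (ℕP.≤-reflexive (ℕP.*-comm x h))))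

    f-count : ∀ x → 1 ℕ.≤ x → x ℕ.≤ b → + f x ≡ ∑ a (λ y → 𝟙 (k ℕ.* y ℕ.<? h ℕ.* x))
    f-count x 1≤x x≤b = sym (begin
      ∑ a (λ y → 𝟙 (k ℕ.* y ℕ.<? h ℕ.* x))
        ≡⟨ ∑-cong a (λ y _ _ → trans (𝟙-cong (k ℕ.* y ℕ.<? h ℕ.* x) (y ℕ.≤? f x) (below⇒≤f x y) (≤f⇒below x y 1≤x x≤b)) (sym (*-identityʳ _))) ⟩
      ∑ a (λ y → 𝟙 (y ℕ.≤? f x) * 1ℤ)
        ≡⟨ ∑-𝟙≤? a (f x) (λ _ → 1ℤ) ⟩
      ∑ (a ℕ.⊓ f x) (λ _ → 1ℤ)
        ≡⟨ cong (λ m → ∑ m (λ _ → 1ℤ)) (ℕP.m≥n⇒m⊓n≡n (f≤a x x≤b)) ⟩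
      ∑ (f x) (λ _ → 1ℤ)
        ≡⟨ trans (∑-const (f x) 1ℤ) (*-identityʳ _) ⟩
      + f x ∎)
      where open ≡-Reasoning

    -- Counting the lattice points (x, y) with k y < h x along columns and along rows.
    2Σxf≡ : + 2 * Σxf ≡ + a * (+ b * K) - Σg² - Σg
    2Σxf≡ = begin
      + 2 * Σxf
        ≡⟨ cong (λ z → + 2 * z) rows ⟩
      + 2 * ∑ a (λ y → Σx - ∑ (g y) (λ x → + x))
        ≡⟨ ∑-*ˡ a (+ 2) _ ⟨
      ∑ a (λ y → + 2 * (Σx - ∑ (g y) (λ x → + x)))
        ≡⟨ ∑-cong a (λ y _ _ → row-value y) ⟩
      ∑ a (λ y → + b * K - (+ g y * + g y + + g y))
        ≡⟨ trans (∑-distrib-- a _ _) (cong₂ _-_ (∑-const a (+ b * K)) (∑-distrib-+ a (λ y → + g y * + g y) (λ y → + g y))) ⟩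
      + a * (+ b * K) - (Σg² + Σg)
        ≡⟨ sub-sum (+ a * (+ b * K)) Σg² Σg ⟩
      + a * (+ b * K) - Σg² - Σg ∎
      where
      open ≡-Reasoning
      sub-sum : ∀ u v w → u - (v + w) ≡ u - v - w
      sub-sum = solve-∀
      rows : Σxf ≡ ∑ a (λ y → Σx - ∑ (g y) (λ x → + x))
      rows = begin
        Σxf
          ≡⟨ ∑-cong b (λ x 1≤x x≤b → trans (*-comm (+ x) (+ f x)) (cong (_* + x) (f-count x 1≤x x≤b))) ⟩
        ∑ b (λ x → ∑ a (λ y → 𝟙 (k ℕ.* y ℕ.<? h ℕ.* x)) * + x)
          ≡⟨ ∑-cong b (λ x _ _ → ∑-*ʳ a (+ x) _) ⟨
        ∑ b (λ x → ∑ a (λ y → 𝟙 (k ℕ.* y ℕ.<? h ℕ.* x) * + x))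
          ≡⟨ ∑-comm b a _ ⟩
        ∑ a (λ y → ∑ b (λ x → 𝟙 (k ℕ.* y ℕ.<? h ℕ.* x) * + x))
          ≡⟨ ∑-cong a (λ y _ _ → ∑-cong b (λ x _ _ → cong (_* + x) (𝟙-cong (k ℕ.* y ℕ.<? h ℕ.* x) (g y ℕ.<? x) (below⇒g< x y) (g<⇒below x y)))) ⟩
        ∑ a (λ y → ∑ b (λ x → 𝟙 (g y ℕ.<? x) * + x))
          ≡⟨ ∑-cong a (λ y _ y≤a → trans (∑-𝟙<? b (g y) (λ x → + x)) (cong (λ m → Σx - ∑ m (λ x → + x)) (ℕP.m≥n⇒m⊓n≡n (g≤b y y≤a)))) ⟩
        ∑ a (λ y → Σx - ∑ (g y) (λ x → + x)) ∎
      row-value : ∀ y → + 2 * (Σx - ∑ (g y) (λ x → + x)) ≡ + b * K - (+ g y * + g y + + g y)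
      row-value y = begin
        + 2 * (Σx - ∑ (g y) (λ x → + x))                     ≡⟨ *-distribˡ-+ (+ 2) Σx _ ⟩
        + 2 * Σx + + 2 * (- ∑ (g y) (λ x → + x))             ≡⟨ cong (λ z → + 2 * Σx + z) (neg-distribʳ-* (+ 2) (∑ (g y) (λ x → + x))) ⟨
        + 2 * Σx - + 2 * ∑ (g y) (λ x → + x)                 ≡⟨ cong₂ _-_ (∑-id b) (∑-id (g y)) ⟩
        + b * (+ b + 1ℤ) - + g y * (+ g y + 1ℤ)              ≡⟨ tidy (+ b) (+ g y) ⟩
        + b * K - (+ g y * + g y + + g y)                    ∎
        where
        tidy : ∀ b g → b * (b + 1ℤ) - g * (g + 1ℤ) ≡ b * (1ℤ + b) - (g * g + g)
        tidy = solve-∀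

  -- The eight relations enter through their defects l - r, which vanish; left side minus right side
  -- equals ∑ cᵢ (lᵢ - rᵢ) as a ring identity.
  reciprocity-algebra : ∀ (a b X Y F G G₂ S₁ S₂ T₁ T₂ : ℤ) → let H = 1ℤ + a ; K = 1ℤ + b in
    + 2 * X ≡ a * (b * K) - G₂ - G →
    (K * K) * T₂ + (- (+ 2 * K * H)) * Y + (H * H) * G₂ ≡ T₂ →
    + 2 * F ≡ a * b → + 2 * G ≡ b * a →
    + 6 * S₂ ≡ b * (b + 1ℤ) * (+ 2 * b + 1ℤ) → + 2 * S₁ ≡ b * (b + 1ℤ) →
    + 6 * T₂ ≡ a * (a + 1ℤ) * (+ 2 * a + 1ℤ) → + 2 * T₁ ≡ a * (a + 1ℤ) →
    + 3 * (H * H) * ((+ 4 * H) * S₂ + (- (+ 4 * K)) * X + (- (+ 2 * K * (1ℤ + H))) * S₁ + (+ 2 * K * K) * F + b * (K * K)) +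
    + 3 * (K * K) * ((+ 4 * K) * T₂ + (- (+ 4 * H)) * Y + (- (+ 2 * H * (1ℤ + K))) * T₁ + (+ 2 * H * H) * G + a * (H * H))
      ≡ H * K * (H * H + K * K + 1ℤ) - + 3 * (H * H) * (K * K)
  reciprocity-algebra a b X Y F G G₂ S₁ S₂ T₁ T₂ e₁ e₂ e₃ e₄ e₅ e₆ e₇ e₈ =
    trans (identity a b X Y F G G₂ S₁ S₂ T₁ T₂) (trans (cong (λ z → R + z)
      (cong₂ _+_ (δ c₁ e₁) (cong₂ _+_ (δ c₂ e₂) (cong₂ _+_ (δ c₃ e₃) (cong₂ _+_ (δ c₄ e₄)
        (cong₂ _+_ (δ c₅ e₅) (cong₂ _+_ (δ c₆ e₆) (cong₂ _+_ (δ c₇ e₇) (δ c₈ e₈))))))))) (+-identityʳ R))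
    where
    H K R c₁ c₂ c₃ c₄ c₅ c₆ c₇ c₈ : ℤ
    H = 1ℤ + a
    K = 1ℤ + b
    R = H * K * (H * H + K * K + 1ℤ) - + 3 * (H * H) * (K * K)
    c₁ = - (+ 6 * H * H * K)
    c₂ = + 6 * K
    c₃ = + 3 * H * H * K * K
    c₄ = + 3 * H * H * K * (K + 1ℤ)
    c₅ = + 2 * H * H * H
    c₆ = - (+ 3 * H * H * (H + 1ℤ) * K)
    c₇ = K * K * K + K
    c₈ = - (+ 3 * K * K * (K + 1ℤ) * H)
    δ : ∀ c {l r : ℤ} → l ≡ r → c * (l - r) ≡ 0ℤ
    δ c {l} refl = trans (cong (c *_) (+-inverseʳ l)) (*-zeroʳ c)
    identity : ∀ a b X Y F G G₂ S₁ S₂ T₁ T₂ → let H = 1ℤ + a ; K = 1ℤ + b in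
      + 3 * (H * H) * ((+ 4 * H) * S₂ + (- (+ 4 * K)) * X + (- (+ 2 * K * (1ℤ + H))) * S₁ + (+ 2 * K * K) * F + b * (K * K)) +
      + 3 * (K * K) * ((+ 4 * K) * T₂ + (- (+ 4 * H)) * Y + (- (+ 2 * H * (1ℤ + K))) * T₁ + (+ 2 * H * H) * G + a * (H * H))
        ≡ (H * K * (H * H + K * K + 1ℤ) - + 3 * (H * H) * (K * K)) +
          ((- (+ 6 * H * H * K)) * (+ 2 * X - (a * (b * K) - G₂ - G)) +
          ((+ 6 * K) * ((K * K) * T₂ + (- (+ 2 * K * H)) * Y + (H * H) * G₂ - T₂) +
          ((+ 3 * H * H * K * K) * (+ 2 * F - a * b) +
          ((+ 3 * H * H * K * (K + 1ℤ)) * (+ 2 * G - b * a) +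
          ((+ 2 * H * H * H) * (+ 6 * S₂ - b * (b + 1ℤ) * (+ 2 * b + 1ℤ)) +
          ((- (+ 3 * H * H * (H + 1ℤ) * K)) * (+ 2 * S₁ - b * (b + 1ℤ)) +
          ((K * K * K + K) * (+ 6 * T₂ - a * (a + 1ℤ) * (+ 2 * a + 1ℤ)) +
          (- (+ 3 * K * K * (K + 1ℤ) * H)) * (+ 2 * T₁ - a * (a + 1ℤ)))))))))
    identity = solve-∀

  reciprocity : ∀ a b → Coprime (suc a) (suc b) →
    + 3 * (+ suc a * + suc a) * D (suc a) b + + 3 * (+ suc b * + suc b) * D (suc b) a
      ≡ + suc a * + suc b * (+ suc a * + suc a + + suc b * + suc b + 1ℤ) - + 3 * (+ suc a * + suc a) * (+ suc b * + suc b)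
  reciprocity a b cop =
    trans (cong₂ (λ u v → + 3 * (+ suc a * + suc a) * u + + 3 * (+ suc b * + suc b) * v) A.D-expand B.D-expand)
          (reciprocity-algebra (+ a) (+ b) A.Σxf B.Σxf A.Σf B.Σf B.Σf² A.Σx A.Σx² B.Σx B.Σx²
             A.2Σxf≡ B.Σr²≡Σx² A.2Σf≡ab B.2Σf≡ab (∑-square b) (∑-id b) (∑-square a) (∑-id a))
    where
    module A = FloorSums a b cop
    module B = FloorSums b a (Cop.sym cop)

  -- Dedekind sums along the Euclidean algorithm

  D-mod : ∀ h m → D h m ≡ D (h % suc m) m
  D-mod h m = ∑-cong m (λ x _ _ → cong (λ z → τ (suc m) x * τ (suc m) z) (sym ([[m%o]*n]%o≡[m*n]%o h x (suc m))))

  coprime-% : ∀ a b → Coprime (suc a) (suc b) → Coprime (suc b % suc a) (suc a)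
  coprime-% a b c {d} (d∣r , d∣a) = c (d∣a , subst (d ℕD.∣_) (sym (m≡m%n+[m/n]*n (suc b) (suc a))) (ℕD.∣m∣n⇒∣m+n d∣r (ℕD.∣n⇒∣m*n (suc b / suc a) d∣a)))

  ∣A-B-c*y∣≤ : ∀ A B c y → ∣ (+ A - + B) - + c * y ∣ ℕ.≤ A ℕ.+ B ℕ.+ c ℕ.* ∣ y ∣
  ∣A-B-c*y∣≤ A B c y = ℕP.≤-trans (∣i-j∣≤∣i∣+∣j∣ (+ A - + B) (+ c * y))
    (ℕP.+-mono-≤ (∣i-j∣≤∣i∣+∣j∣ (+ A) (+ B)) (ℕP.≤-reflexive (abs-* (+ c) y)))

  -- Reciprocity as one step (r′, r) ↦ (r, r′ mod r) of the Euclidean algorithm.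
  reciprocity-≤ : ∀ a b → Coprime (suc a) (suc b) → let r = suc a ; r′ = suc b in
    3 ℕ.* (r ℕ.* r) ℕ.* ∣ D r b ∣ ℕ.≤
      r ℕ.* r′ ℕ.* (r ℕ.* r ℕ.+ r′ ℕ.* r′ ℕ.+ 1) ℕ.+ 3 ℕ.* (r ℕ.* r) ℕ.* (r′ ℕ.* r′) ℕ.+ 3 ℕ.* (r′ ℕ.* r′) ℕ.* ∣ D (r′ % r) a ∣
  reciprocity-≤ a b cop = ℕP.≤-trans
    (ℕP.≤-reflexive (trans (sym (abs-* (+ (3 ℕ.* (r ℕ.* r))) (D r b))) (cong ∣_∣ isolate)))
    (∣A-B-c*y∣≤ A B (3 ℕ.* (r′ ℕ.* r′)) (D (r′ % r) a))
    where
    r r′ A B : ℕ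
    r = suc a
    r′ = suc b
    A = r ℕ.* r′ ℕ.* (r ℕ.* r ℕ.+ r′ ℕ.* r′ ℕ.+ 1)
    B = 3 ℕ.* (r ℕ.* r) ℕ.* (r′ ℕ.* r′)
    +3r² : + (3 ℕ.* (r ℕ.* r)) ≡ + 3 * (+ r * + r)
    +3r² = trans (pos-* 3 (r ℕ.* r)) (cong (+ 3 *_) (pos-* r r))
    +3r′² : + (3 ℕ.* (r′ ℕ.* r′)) ≡ + 3 * (+ r′ * + r′)
    +3r′² = trans (pos-* 3 (r′ ℕ.* r′)) (cong (+ 3 *_) (pos-* r′ r′))
    +A : + A ≡ + r * + r′ * (+ r * + r + + r′ * + r′ + 1ℤ)
    +A = trans (pos-* (r ℕ.* r′) _) (cong₂ _*_ (pos-* r r′) (trans (pos-+ (r ℕ.* r ℕ.+ r′ ℕ.* r′) 1)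
           (cong (_+ 1ℤ) (trans (pos-+ (r ℕ.* r) (r′ ℕ.* r′)) (cong₂ _+_ (pos-* r r) (pos-* r′ r′))))))
    +B : + B ≡ + 3 * (+ r * + r) * (+ r′ * + r′)
    +B = trans (pos-* (3 ℕ.* (r ℕ.* r)) (r′ ℕ.* r′)) (cong₂ _*_ +3r² (pos-* r′ r′))
    move : ∀ x y → x ≡ (x + y) - y
    move = solve-∀
    isolate : + (3 ℕ.* (r ℕ.* r)) * D r b ≡ (+ A - + B) - + (3 ℕ.* (r′ ℕ.* r′)) * D (r′ % r) a
    isolate = begin
      + (3 ℕ.* (r ℕ.* r)) * D r b
        ≡⟨ move _ (+ (3 ℕ.* (r′ ℕ.* r′)) * D r′ a) ⟩
      (+ (3 ℕ.* (r ℕ.* r)) * D r b + + (3 ℕ.* (r′ ℕ.* r′)) * D r′ a) - + (3 ℕ.* (r′ ℕ.* r′)) * D r′ a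
        ≡⟨ cong₂ (λ u v → (u * D r b + v * D r′ a) - v * D r′ a) +3r² +3r′² ⟩
      (+ 3 * (+ r * + r) * D r b + + 3 * (+ r′ * + r′) * D r′ a) - + 3 * (+ r′ * + r′) * D r′ a
        ≡⟨ cong₂ _-_ (trans (reciprocity a b cop) (sym (cong₂ _-_ +A +B))) (cong₂ _*_ (sym +3r′²) (D-mod r′ a)) ⟩
      (+ A - + B) - + (3 ℕ.* (r′ ℕ.* r′)) * D (r′ % r) a ∎
      where open ≡-Reasoning

  main-term≤ : ∀ r r′ q → 1 ℕ.≤ r → 1 ℕ.≤ q → r ℕ.≤ r′ → r′ ℕ.≤ r ℕ.* suc q →
    r ℕ.* r′ ℕ.* (r ℕ.* r ℕ.+ r′ ℕ.* r′ ℕ.+ 1) ℕ.+ 3 ℕ.* (r ℕ.* r) ℕ.* (r′ ℕ.* r′) ℕ.≤ 12 ℕ.* (r ℕ.* r) ℕ.* (r′ ℕ.* r′) ℕ.* q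
  main-term≤ r r′ q 1≤r 1≤q r≤r′ r′≤r[1+q] = begin
    X ℕ.* (r ℕ.* r ℕ.+ r′ ℕ.* r′ ℕ.+ 1) ℕ.+ 3 ℕ.* (r ℕ.* r) ℕ.* (r′ ℕ.* r′) ≡⟨ cong (X ℕ.* (r ℕ.* r ℕ.+ r′ ℕ.* r′ ℕ.+ 1) ℕ.+_) (square-product r r′) ⟩
    X ℕ.* (r ℕ.* r ℕ.+ r′ ℕ.* r′ ℕ.+ 1) ℕ.+ 3 ℕ.* (X ℕ.* X)                 ≤⟨ ℕP.+-monoˡ-≤ (3 ℕ.* (X ℕ.* X)) (ℕP.*-monoʳ-≤ X squares≤) ⟩
    X ℕ.* (X ℕ.+ (X ℕ.* q ℕ.+ X) ℕ.+ X) ℕ.+ 3 ℕ.* (X ℕ.* X)                 ≡⟨ collect X q ⟩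
    X ℕ.* X ℕ.* (q ℕ.+ 6)                                                  ≤⟨ ℕP.*-monoʳ-≤ (X ℕ.* X) q+6≤12q ⟩
    X ℕ.* X ℕ.* (12 ℕ.* q)                                                 ≡⟨ spread r r′ q ⟩
    12 ℕ.* (r ℕ.* r) ℕ.* (r′ ℕ.* r′) ℕ.* q                                 ∎
    where
    open ℕP.≤-Reasoning
    X : ℕ
    X = r ℕ.* r′
    square-product : ∀ r r′ → 3 ℕ.* (r ℕ.* r) ℕ.* (r′ ℕ.* r′) ≡ 3 ℕ.* (r ℕ.* r′ ℕ.* (r ℕ.* r′))
    square-product = ℕSolver.solve-∀
    collect : ∀ x q → x ℕ.* (x ℕ.+ (x ℕ.* q ℕ.+ x) ℕ.+ x) ℕ.+ 3 ℕ.* (x ℕ.* x) ≡ x ℕ.* x ℕ.* (q ℕ.+ 6)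
    collect = ℕSolver.solve-∀
    spread : ∀ r r′ q → r ℕ.* r′ ℕ.* (r ℕ.* r′) ℕ.* (12 ℕ.* q) ≡ 12 ℕ.* (r ℕ.* r) ℕ.* (r′ ℕ.* r′) ℕ.* q
    spread = ℕSolver.solve-∀
    r′r′≤Xq+X : r′ ℕ.* r′ ℕ.≤ X ℕ.* q ℕ.+ X
    r′r′≤Xq+X = ℕP.≤-trans (ℕP.*-monoʳ-≤ r′ r′≤r[1+q]) (ℕP.≤-reflexive (expand r r′ q))
      where
      expand : ∀ r r′ q → r′ ℕ.* (r ℕ.* suc q) ≡ r ℕ.* r′ ℕ.* q ℕ.+ r ℕ.* r′
      expand = ℕSolver.solve-∀
    squares≤ : r ℕ.* r ℕ.+ r′ ℕ.* r′ ℕ.+ 1 ℕ.≤ X ℕ.+ (X ℕ.* q ℕ.+ X) ℕ.+ X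
    squares≤ = ℕP.+-mono-≤ (ℕP.+-mono-≤ (ℕP.*-monoʳ-≤ r r≤r′) r′r′≤Xq+X) (ℕP.*-mono-≤ 1≤r (ℕP.≤-trans 1≤r r≤r′))
    q+6≤12q : q ℕ.+ 6 ℕ.≤ 12 ℕ.* q
    q+6≤12q = ℕP.≤-trans (ℕP.+-monoʳ-≤ q (ℕP.*-monoʳ-≤ 6 1≤q)) (ℕP.≤-trans (ℕP.≤-reflexive (seven q)) (ℕP.*-monoˡ-≤ q (ℕP.m≤m+n 7 5)))
      where
      seven : ∀ q → q ℕ.+ 6 ℕ.* q ≡ 7 ℕ.* q
      seven = ℕSolver.solve-∀

  ⌊_/_⌋ : ℕ → ℕ → ℕ
  ⌊ x / zero  ⌋ = 0
  ⌊ x / suc m ⌋ = x / suc m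

  module EuclideanBound (p : ℕ) where
    Q : ℕ → ℕ → ℕ
    Q u r = ⌊ ⌊ p / u ⌋ / r ⌋

    -- Runs the Euclidean algorithm on (r′, r) (for at most t steps) while computing the
    -- denominators u′, u of the convergents, and adds up the bounds Q u r for the partial quotients.
    euclid-sum : (t r′ r u′ u : ℕ) → ℕ
    euclid-sum zero    r′ r        u′ u = 0
    euclid-sum (suc t) r′ zero     u′ u = 0
    euclid-sum (suc t) r′ (suc r₀) u′ u = Q u (suc r₀) ℕ.+ euclid-sum t (suc r₀) (r′ % suc r₀) u (u′ ℕ.+ (r′ / suc r₀) ℕ.* u)

    quotient≤Q : ∀ r′ r₀ u′ u → 1 ℕ.≤ u → u ℕ.* r′ ℕ.+ u′ ℕ.* suc r₀ ℕ.≤ p → r′ / suc r₀ ℕ.≤ Q u (suc r₀)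
    quotient≤Q r′ r₀ u′ (suc u₀) _ u≤ = begin
      r′ / r                 ≡⟨ m*n/n≡m (r′ / r) r ⟨
      (r′ / r ℕ.* r) / r     ≤⟨ /-monoˡ-≤ r (ℕP.≤-trans (ℕP.≤-reflexive (sym (m*n/n≡m (r′ / r ℕ.* r) u))) (/-monoˡ-≤ u qru≤p)) ⟩
      (p / u) / r            ∎
      where
      open ℕP.≤-Reasoning
      r u : ℕ
      r = suc r₀
      u = suc u₀
      qru≤p : r′ / r ℕ.* r ℕ.* u ℕ.≤ p
      qru≤p = ℕP.≤-trans (ℕP.*-monoˡ-≤ u (m/n*n≤m r′ r))
                (ℕP.≤-trans (ℕP.≤-reflexive (ℕP.*-comm r′ u)) (ℕP.≤-trans (ℕP.m≤m+n (u ℕ.* r′) (u′ ℕ.* r)) u≤))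

    quotient≥1 : ∀ r′ r₀ → suc r₀ ℕ.< r′ → 1 ℕ.≤ r′ / suc r₀
    quotient≥1 r′ r₀ r<r′ = subst (ℕ._≤ r′ / suc r₀) (n/n≡1 (suc r₀)) (/-monoˡ-≤ (suc r₀) (ℕP.<⇒≤ r<r′))

    denominator≥1 : ∀ r′ r₀ u′ u → suc r₀ ℕ.< r′ → 1 ℕ.≤ u → 1 ℕ.≤ u′ ℕ.+ (r′ / suc r₀) ℕ.* u
    denominator≥1 r′ r₀ u′ u r<r′ 1≤u =
      ℕP.≤-trans (ℕP.*-mono-≤ (quotient≥1 r′ r₀ r<r′) 1≤u) (ℕP.m≤n+m ((r′ / suc r₀) ℕ.* u) u′)

    invariant-step : ∀ r′ r₀ u′ u → u ℕ.* r′ ℕ.+ u′ ℕ.* suc r₀ ℕ.≤ p →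
      (u′ ℕ.+ (r′ / suc r₀) ℕ.* u) ℕ.* suc r₀ ℕ.+ u ℕ.* (r′ % suc r₀) ℕ.≤ p
    invariant-step r′ r₀ u′ u u≤ =
      ℕP.≤-trans (ℕP.≤-reflexive (trans (regroup u′ (r′ / suc r₀) u (suc r₀) (r′ % suc r₀))
                                          (cong (λ z → u′ ℕ.* suc r₀ ℕ.+ u ℕ.* z) (sym (m≡m%n+[m/n]*n r′ (suc r₀))))))
                 (subst (ℕ._≤ p) (ℕP.+-comm (u ℕ.* r′) (u′ ℕ.* suc r₀)) u≤)
      where
      regroup : ∀ u′ q u r r₂ → (u′ ℕ.+ q ℕ.* u) ℕ.* r ℕ.+ u ℕ.* r₂ ≡ u′ ℕ.* r ℕ.+ u ℕ.* (r₂ ℕ.+ q ℕ.* r)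
      regroup = ℕSolver.solve-∀

    ∣D∣≤euclid-sum : ∀ t b r u′ u → r ℕ.< t → r ℕ.< suc b → Coprime r (suc b) → 1 ℕ.≤ u → u ℕ.* suc b ℕ.+ u′ ℕ.* r ℕ.≤ p →
         ∣ D r b ∣ ℕ.≤ suc b ℕ.* suc b ℕ.* (4 ℕ.* euclid-sum t (suc b) r u′ u)
    ∣D∣≤euclid-sum (suc t) b zero    u′ u _ _ c _ _ with ℕP.suc-injective (Cop.0-coprimeTo-m⇒m≡1 c)
    ... | refl = z≤n
    ∣D∣≤euclid-sum (suc t) b (suc a) u′ u r<1+t r<r′ c 1≤u u≤ = ℕP.*-cancelˡ-≤ (3 ℕ.* (r ℕ.* r)) (begin
      3 ℕ.* (r ℕ.* r) ℕ.* ∣ D r b ∣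
        ≤⟨ reciprocity-≤ a b c ⟩
      r ℕ.* r′ ℕ.* (r ℕ.* r ℕ.+ r′ ℕ.* r′ ℕ.+ 1) ℕ.+ 3 ℕ.* (r ℕ.* r) ℕ.* (r′ ℕ.* r′) ℕ.+ 3 ℕ.* (r′ ℕ.* r′) ℕ.* ∣ D r₂ a ∣
        ≤⟨ ℕP.+-mono-≤ (main-term≤ r r′ q (s≤s z≤n) 1≤q (ℕP.<⇒≤ r<r′) r′≤r[1+q]) (ℕP.*-monoʳ-≤ (3 ℕ.* (r′ ℕ.* r′)) IH) ⟩
      12 ℕ.* (r ℕ.* r) ℕ.* (r′ ℕ.* r′) ℕ.* q ℕ.+ 3 ℕ.* (r′ ℕ.* r′) ℕ.* (r ℕ.* r ℕ.* (4 ℕ.* E′))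
        ≤⟨ ℕP.+-monoˡ-≤ _ (ℕP.*-monoʳ-≤ (12 ℕ.* (r ℕ.* r) ℕ.* (r′ ℕ.* r′)) (quotient≤Q r′ a u′ u 1≤u u≤)) ⟩
      12 ℕ.* (r ℕ.* r) ℕ.* (r′ ℕ.* r′) ℕ.* Q u r ℕ.+ 3 ℕ.* (r′ ℕ.* r′) ℕ.* (r ℕ.* r ℕ.* (4 ℕ.* E′))
        ≡⟨ collect r r′ (Q u r) E′ ⟩
      3 ℕ.* (r ℕ.* r) ℕ.* (r′ ℕ.* r′ ℕ.* (4 ℕ.* (Q u r ℕ.+ E′))) ∎)
      where
      open ℕP.≤-Reasoning
      r r′ q r₂ u₂ E′ : ℕ
      r = suc a
      r′ = suc b
      q = r′ / r
      r₂ = r′ % r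
      u₂ = u′ ℕ.+ q ℕ.* u
      E′ = euclid-sum t r r₂ u u₂
      1≤q : 1 ℕ.≤ q
      1≤q = quotient≥1 r′ a r<r′
      r′≤r[1+q] : r′ ℕ.≤ r ℕ.* suc q
      r′≤r[1+q] = ℕP.≤-trans (ℕP.≤-reflexive (m≡m%n+[m/n]*n r′ r))
                    (ℕP.≤-trans (ℕP.+-monoˡ-≤ (q ℕ.* r) (ℕP.<⇒≤ (m%n<n r′ r))) (ℕP.≤-reflexive (ℕP.*-comm (suc q) r)))
      IH : ∣ D r₂ a ∣ ℕ.≤ r ℕ.* r ℕ.* (4 ℕ.* E′)
      IH = ∣D∣≤euclid-sum t a r₂ u u₂ (ℕP.<-≤-trans (m%n<n r′ r) (ℕP.≤-pred r<1+t)) (m%n<n r′ r) (coprime-% a b c)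
             (denominator≥1 r′ a u′ u r<r′ 1≤u) (invariant-step r′ a u′ u u≤)
      collect : ∀ r r′ Q E → 12 ℕ.* (r ℕ.* r) ℕ.* (r′ ℕ.* r′) ℕ.* Q ℕ.+ 3 ℕ.* (r′ ℕ.* r′) ℕ.* (r ℕ.* r ℕ.* (4 ℕ.* E)) ≡ 3 ℕ.* (r ℕ.* r) ℕ.* (r′ ℕ.* r′ ℕ.* (4 ℕ.* (Q ℕ.+ E)))
      collect = ℕSolver.solve-∀

  module DedekindSumAverage (m : ℕ) (pr : Prime (2 ℕ.+ m)) where
    open PrimeModulus m pr
    open EuclideanBound p

    Congruent : ℕ → Bool → ℕ → ℕ → Set
    Congruent ℓ true  u r = P ℤD.∣ (+ u * + ℓ - + r)
    Congruent ℓ false u r = P ℤD.∣ (+ u * + ℓ + + r)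

    signs : ℕ → ℕ → ℕ → ℤ
    signs ℓ u r = 𝟙 (P ∣? (+ u * + ℓ - + r)) + 𝟙 (P ∣? (+ u * + ℓ + + r))

    weight : ℕ → ℕ → ℤ
    weight ℓ r = ∑ n (λ u → + Q u r * signs ℓ u r)

    signs-nonNeg : ∀ ℓ u r → 0ℤ ≤ signs ℓ u r
    signs-nonNeg ℓ u r = +-mono-≤ (𝟙-nonNeg _) (𝟙-nonNeg _)

    Congruent⇒signs≥1 : ∀ ℓ σ u r → Congruent ℓ σ u r → 1ℤ ≤ signs ℓ u r
    Congruent⇒signs≥1 ℓ true  u r c = subst (_≤ signs ℓ u r) (cong (_+ 0ℤ) (𝟙-yes (P ∣? (+ u * + ℓ - + r)) c))
                                        (+-monoʳ-≤ (𝟙 (P ∣? (+ u * + ℓ - + r))) (𝟙-nonNeg _))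
    Congruent⇒signs≥1 ℓ false u r c = subst (_≤ signs ℓ u r) (cong (λ z → 0ℤ + z) (𝟙-yes (P ∣? (+ u * + ℓ + + r)) c))
                                        (+-monoˡ-≤ (𝟙 (P ∣? (+ u * + ℓ + + r))) (𝟙-nonNeg _))

    weight-nonNeg : ∀ ℓ r → 0ℤ ≤ weight ℓ r
    weight-nonNeg ℓ r = ∑-nonNeg n (λ u _ _ → *-nonNeg (+ Q u r) (signs ℓ u r) (+≤+ z≤n) (signs-nonNeg ℓ u r))

    -- The signs alternate along the Euclidean algorithm: u′ ℓ ≡ ∓ r′ and u ℓ ≡ ± r give
    -- (u′ + q u) ℓ ≡ ∓ (r′ - q r).
    congruent-step : ∀ ℓ σ u r u′ q r₂ →
      Congruent ℓ σ u r → Congruent ℓ (not σ) u′ (r₂ ℕ.+ q ℕ.* r) → Congruent ℓ (not σ) (u′ ℕ.+ q ℕ.* u) r₂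
    congruent-step ℓ true u r u′ q r₂ c c′ = subst (P ℤD.∣_) regroup (∣m∣n⇒∣m+n c′ (∣n⇒∣m*n (+ q) c))
      where
      shift : ∀ u′ q u ℓ r r₂ → (u′ * ℓ + (r₂ + q * r)) + q * (u * ℓ - r) ≡ (u′ + q * u) * ℓ + r₂
      shift = solve-∀
      regroup : (+ u′ * + ℓ + + (r₂ ℕ.+ q ℕ.* r)) + + q * (+ u * + ℓ - + r) ≡ + (u′ ℕ.+ q ℕ.* u) * + ℓ + + r₂
      regroup = trans (cong (λ z → (+ u′ * + ℓ + z) + + q * (+ u * + ℓ - + r)) (pos-+* r₂ q r))
                  (trans (shift (+ u′) (+ q) (+ u) (+ ℓ) (+ r) (+ r₂)) (cong (λ z → z * + ℓ + + r₂) (sym (pos-+* u′ q u))))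
    congruent-step ℓ false u r u′ q r₂ c c′ = subst (P ℤD.∣_) regroup (∣m∣n⇒∣m+n c′ (∣n⇒∣m*n (+ q) c))
      where
      shift : ∀ u′ q u ℓ r r₂ → (u′ * ℓ - (r₂ + q * r)) + q * (u * ℓ + r) ≡ (u′ + q * u) * ℓ - r₂
      shift = solve-∀
      regroup : (+ u′ * + ℓ - + (r₂ ℕ.+ q ℕ.* r)) + + q * (+ u * + ℓ + + r) ≡ + (u′ ℕ.+ q ℕ.* u) * + ℓ - + r₂
      regroup = trans (cong (λ z → (+ u′ * + ℓ - z) + + q * (+ u * + ℓ + + r)) (pos-+* r₂ q r))
                  (trans (shift (+ u′) (+ q) (+ u) (+ ℓ) (+ r) (+ r₂)) (cong (λ z → z * + ℓ - + r₂) (sym (pos-+* u′ q u))))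

    Q≤weight : ∀ ℓ σ u r → Congruent ℓ σ u r → 1 ℕ.≤ u → u ℕ.≤ n → + Q u r ≤ weight ℓ r
    Q≤weight ℓ σ u r c 1≤u u≤n = ≤-trans
      (subst (_≤ + Q u r * signs ℓ u r) (*-identityʳ (+ Q u r)) (*-monoˡ-≤-nonNeg (+ Q u r) (Congruent⇒signs≥1 ℓ σ u r c)))
      (term≤∑ n u (λ u′ → + Q u′ r * signs ℓ u′ r) 1≤u u≤n (λ u′ → *-nonNeg (+ Q u′ r) (signs ℓ u′ r) (+≤+ z≤n) (signs-nonNeg ℓ u′ r)))

    euclid-sum≤∑weight : ∀ ℓ t r′ r u′ u σ → Congruent ℓ σ u r → Congruent ℓ (not σ) u′ r′ →
      r ℕ.< r′ → 1 ℕ.≤ u → u ℕ.* r′ ℕ.+ u′ ℕ.* r ℕ.≤ p → + euclid-sum t r′ r u′ u ≤ ∑ r (weight ℓ)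
    euclid-sum≤∑weight ℓ zero    r′ r       u′ u σ _ _ _ _ _ = ∑-nonNeg r (λ i _ _ → weight-nonNeg ℓ i)
    euclid-sum≤∑weight ℓ (suc t) r′ zero    u′ u σ _ _ _ _ _ = ≤-refl
    euclid-sum≤∑weight ℓ (suc t) r′ (suc a) u′ u σ c c′ r<r′ 1≤u u≤ =
      subst (_≤ ∑ a (weight ℓ) + weight ℓ r) (+-comm (+ euclid-sum t r r₂ u u₂) (+ Q u r))
        (+-mono-≤ (≤-trans IH (∑-mono-≤-range r₂ a (weight ℓ) (ℕP.≤-pred (m%n<n r′ r)) (weight-nonNeg ℓ)))
                  (Q≤weight ℓ σ u r c 1≤u u≤n))
      where
      r q r₂ u₂ : ℕ
      r = suc a
      q = r′ / r
      r₂ = r′ % r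
      u₂ = u′ ℕ.+ q ℕ.* u
      r′≡r₂+qr : r′ ≡ r₂ ℕ.+ q ℕ.* r
      r′≡r₂+qr = m≡m%n+[m/n]*n r′ r
      u≤n : u ℕ.≤ n
      u≤n = ℕP.≤-pred (ℕP.<-≤-trans u<u*r′ (ℕP.≤-trans (ℕP.m≤m+n (u ℕ.* r′) (u′ ℕ.* r)) u≤))
        where
        u<u*r′ : u ℕ.< u ℕ.* r′
        u<u*r′ = ℕP.m<m*n u r′ {{ℕ.>-nonZero 1≤u}} (ℕP.≤-<-trans (s≤s z≤n) r<r′)
      IH : + euclid-sum t r r₂ u u₂ ≤ ∑ r₂ (weight ℓ)
      IH = euclid-sum≤∑weight ℓ t r r₂ u u₂ (not σ)
             (congruent-step ℓ σ u r u′ q r₂ c (subst (Congruent ℓ (not σ) u′) r′≡r₂+qr c′))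
             (subst (λ s → Congruent ℓ s u r) (sym (not-involutive σ)) c)
             (m%n<n r′ r) (denominator≥1 r′ a u′ u r<r′ 1≤u) (invariant-step r′ a u′ u u≤)

    -- For a unit u, each of u ℓ ≡ r and u ℓ ≡ - r has at most one solution ℓ.
    ∑-signs≤2 : ∀ u r → 1 ℕ.≤ u → u ℕ.≤ n → ∑ n (λ ℓ → signs ℓ u r) ≤ + 2
    ∑-signs≤2 u r 1≤u u≤n = subst (_≤ + 2) (sym (∑-distrib-+ n _ _))
      (+-mono-≤ (∑-𝟙-unique n (λ ℓ → P ∣? (+ u * + ℓ - + r)) (λ i j i≤n j≤n ci cj → cancel i j i≤n j≤n (∣m∣n⇒∣m-n ci cj) (minus (+ u) (+ i) (+ j) (+ r))))
                (∑-𝟙-unique n (λ ℓ → P ∣? (+ u * + ℓ + + r)) (λ i j i≤n j≤n ci cj → cancel i j i≤n j≤n (∣m∣n⇒∣m-n ci cj) (plus (+ u) (+ i) (+ j) (+ r)))))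
      where
      cancel : ∀ i j {z} → i ℕ.≤ n → j ℕ.≤ n → P ℤD.∣ z → z ≡ + u * (+ i - + j) → i ≡ j
      cancel i j i≤n j≤n p∣z refl = p∣u[x-y]⇒x≡y u i j 1≤u u≤n i≤n j≤n p∣z
      minus : ∀ u i j r → (u * i - r) - (u * j - r) ≡ u * (i - j)
      minus = solve-∀
      plus : ∀ u i j r → (u * i + r) - (u * j + r) ≡ u * (i - j)
      plus = solve-∀

    ∣D∣≤∑weight : ∀ ℓ → 1 ℕ.≤ ℓ → ℓ ℕ.≤ n → + ∣ D ℓ n ∣ ≤ + (4 ℕ.* (p ℕ.* p)) * ∑ n (weight ℓ)
    ∣D∣≤∑weight ℓ 1≤ℓ ℓ≤n = begin
      + ∣ D ℓ n ∣
        ≤⟨ +≤+ (∣D∣≤euclid-sum p n ℓ 0 1 ℓ<p ℓ<p (coprime ℓ 1≤ℓ ℓ≤n) (s≤s z≤n) 1p+0ℓ≤p) ⟩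
      + (p ℕ.* p ℕ.* (4 ℕ.* E))
        ≡⟨ cong +_ (regroup p E) ⟩
      + (4 ℕ.* (p ℕ.* p) ℕ.* E)
        ≡⟨ pos-* (4 ℕ.* (p ℕ.* p)) E ⟩
      + (4 ℕ.* (p ℕ.* p)) * + E
        ≤⟨ *-monoˡ-≤-nonNeg (+ (4 ℕ.* (p ℕ.* p))) (≤-trans E≤∑weight (∑-mono-≤-range ℓ n (weight ℓ) ℓ≤n (weight-nonNeg ℓ))) ⟩
      + (4 ℕ.* (p ℕ.* p)) * ∑ n (weight ℓ) ∎
      where
      open ≤-Reasoning
      E : ℕ
      E = euclid-sum p p ℓ 0 1
      ℓ<p : ℓ ℕ.< p
      ℓ<p = s≤s ℓ≤n
      1p+0ℓ≤p : 1 ℕ.* p ℕ.+ 0 ℕ.* ℓ ℕ.≤ p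
      1p+0ℓ≤p = ℕP.≤-reflexive (trans (ℕP.+-identityʳ (1 ℕ.* p)) (ℕP.*-identityˡ p))
      regroup : ∀ p E → p ℕ.* p ℕ.* (4 ℕ.* E) ≡ 4 ℕ.* (p ℕ.* p) ℕ.* E
      regroup = ℕSolver.solve-∀
      1ℓ≡ℓ : Congruent ℓ true 1 ℓ
      1ℓ≡ℓ = subst (P ℤD.∣_) (sym (trans (cong (λ z → z - + ℓ) (*-identityˡ (+ ℓ))) (+-inverseʳ (+ ℓ)))) (∣ᵤ⇒∣ (ℕD._∣0 p))
      E≤∑weight : + E ≤ ∑ ℓ (weight ℓ)
      E≤∑weight = euclid-sum≤∑weight ℓ p p ℓ 0 1 true 1ℓ≡ℓ ℤD.∣-refl ℓ<p (s≤s z≤n) 1p+0ℓ≤p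

    ∑∣D∣≤ : ∑ n (λ ℓ → + ∣ D ℓ n ∣) ≤ + (4 ℕ.* (p ℕ.* p)) * (+ 2 * ∑ n (λ r → ∑ n (λ u → + Q u r)))
    ∑∣D∣≤ = begin
      ∑ n (λ ℓ → + ∣ D ℓ n ∣)                                           ≤⟨ ∑-mono-≤ n ∣D∣≤∑weight ⟩
      ∑ n (λ ℓ → + (4 ℕ.* (p ℕ.* p)) * ∑ n (weight ℓ))                  ≡⟨ ∑-*ˡ n (+ (4 ℕ.* (p ℕ.* p))) _ ⟩
      + (4 ℕ.* (p ℕ.* p)) * ∑ n (λ ℓ → ∑ n (weight ℓ))                  ≤⟨ *-monoˡ-≤-nonNeg (+ (4 ℕ.* (p ℕ.* p))) ∑∑weight≤ ⟩
      + (4 ℕ.* (p ℕ.* p)) * (+ 2 * ∑ n (λ r → ∑ n (λ u → + Q u r)))     ∎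
      where
      open ≤-Reasoning
      ∑∑weight≤ : ∑ n (λ ℓ → ∑ n (weight ℓ)) ≤ + 2 * ∑ n (λ r → ∑ n (λ u → + Q u r))
      ∑∑weight≤ = begin
        ∑ n (λ ℓ → ∑ n (λ r → ∑ n (λ u → + Q u r * signs ℓ u r)))
          ≡⟨ trans (∑-comm n n _) (∑-cong n (λ r _ _ → ∑-comm n n _)) ⟩
        ∑ n (λ r → ∑ n (λ u → ∑ n (λ ℓ → + Q u r * signs ℓ u r)))
          ≡⟨ ∑-cong n (λ r _ _ → ∑-cong n (λ u _ _ → ∑-*ˡ n (+ Q u r) (λ ℓ → signs ℓ u r))) ⟩
        ∑ n (λ r → ∑ n (λ u → + Q u r * ∑ n (λ ℓ → signs ℓ u r)))
          ≤⟨ ∑-mono-≤ n (λ r _ _ → ∑-mono-≤ n (λ u 1≤u u≤n → *-monoˡ-≤-nonNeg (+ Q u r) (∑-signs≤2 u r 1≤u u≤n))) ⟩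
        ∑ n (λ r → ∑ n (λ u → + Q u r * + 2))
          ≡⟨ trans (∑-cong n (λ r _ _ → ∑-*ʳ n (+ 2) (λ u → + Q u r))) (∑-*ʳ n (+ 2) _) ⟩
        ∑ n (λ r → ∑ n (λ u → + Q u r)) * + 2
          ≡⟨ *-comm _ (+ 2) ⟩
        + 2 * ∑ n (λ r → ∑ n (λ u → + Q u r)) ∎

  -- The terms with N/2 < r ≤ N add up to at most M.
  ∑-⌊M/r⌋≤ : ∀ j N M → N ℕ.< 2 ^ j → ∑ N (λ r → + ⌊ M / r ⌋) ≤ + (M ℕ.* j)
  ∑-⌊M/r⌋≤ zero    zero    M _ = +≤+ z≤n
  ∑-⌊M/r⌋≤ zero    (suc N) M (s≤s ())
  ∑-⌊M/r⌋≤ (suc j) N       M N<2^[1+j] = begin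
    ∑ N F                                ≡⟨ cong (λ z → ∑ z F) (sym (ℕP.m+[n∸m]≡n N′≤N)) ⟩
    ∑ (N′ ℕ.+ c) F                       ≡⟨ ∑-split N′ c F ⟩
    ∑ N′ F + ∑ c (λ i → F (N′ ℕ.+ i))    ≤⟨ +-mono-≤ (∑-⌊M/r⌋≤ j N′ M N′<2^j) upper-half≤M ⟩
    + (M ℕ.* j) + + M                    ≡⟨ cong +_ (trans (ℕP.+-comm (M ℕ.* j) M) (sym (ℕP.*-suc M j))) ⟩
    + (M ℕ.* suc j)                      ∎
    where
    open ≤-Reasoning
    F : ℕ → ℤ
    F r = + ⌊ M / r ⌋
    N′ c : ℕ
    N′ = N / 2
    c = N ℕ.∸ N′
    N′≤N : N′ ℕ.≤ N
    N′≤N = m/n≤m N 2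
    N′<2^j : N′ ℕ.< 2 ^ j
    N′<2^j = m<n*o⇒m/o<n {N} {2 ^ j} {2} (subst (N ℕ.<_) (ℕP.*-comm 2 (2 ^ j)) N<2^[1+j])
    N≤1+2N′ : N ℕ.≤ suc (N′ ℕ.+ N′)
    N≤1+2N′ = subst (ℕ._≤ suc (N′ ℕ.+ N′)) (sym (m≡m%n+[m/n]*n N 2))
                (ℕP.+-mono-≤ (ℕP.≤-pred (m%n<n N 2)) (ℕP.≤-reflexive (trans (ℕP.*-comm N′ 2) (cong (N′ ℕ.+_) (ℕP.+-identityʳ N′)))))
    c≤1+N′ : c ℕ.≤ suc N′
    c≤1+N′ = ℕP.≤-trans (ℕP.∸-monoˡ-≤ N′ N≤1+2N′) (ℕP.≤-reflexive (trans (cong (ℕ._∸ N′) (sym (ℕP.+-suc N′ N′))) (ℕP.m+n∸m≡n N′ (suc N′))))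
    term≤ : ∀ i → 1 ℕ.≤ i → i ℕ.≤ c → F (N′ ℕ.+ i) ≤ + (M / suc N′)
    term≤ (suc i) _ _ = +≤+ (subst (ℕ._≤ M / suc N′) (cong (λ z → ⌊ M / z ⌋) (sym (ℕP.+-suc N′ i))) (/-monoʳ-≤ M (s≤s (ℕP.m≤m+n N′ i))))
    upper-half≤M : ∑ c (λ i → F (N′ ℕ.+ i)) ≤ + M
    upper-half≤M = begin
      ∑ c (λ i → F (N′ ℕ.+ i))
        ≤⟨ ∑-mono-≤ c term≤ ⟩
      ∑ c (λ _ → + (M / suc N′))
        ≡⟨ trans (∑-const c _) (sym (pos-* c (M / suc N′))) ⟩
      + (c ℕ.* (M / suc N′))
        ≤⟨ +≤+ (ℕP.≤-trans (ℕP.*-monoˡ-≤ (M / suc N′) c≤1+N′) (ℕP.≤-trans (ℕP.≤-reflexive (ℕP.*-comm (suc N′) (M / suc N′))) (m/n*n≤m M (suc N′)))) ⟩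
      + M ∎

  n<2^[1+⌊log₂n⌋] : ∀ n → n ℕ.< 2 ^ suc ⌊log₂ n ⌋
  n<2^[1+⌊log₂n⌋] n with n ℕ.<? 2 ^ suc ⌊log₂ n ⌋
  ... | yes n< = n<
  ... | no  n≮ = ⊥-elim (ℕP.<-irrefl refl (subst (ℕ._≤ ⌊log₂ n ⌋) (⌊log₂[2^n]⌋≡n (suc ⌊log₂ n ⌋)) (⌊log₂⌋-mono-≤ (ℕP.≮⇒≥ n≮))))

  ∑∑Q≤ : ∀ n → let L = suc ⌊log₂ suc n ⌋ in
    ∑ n (λ r → ∑ n (λ u → + EuclideanBound.Q (suc n) u r)) ≤ + (suc n ℕ.* L) * + L
  ∑∑Q≤ n = begin
    ∑ n (λ r → ∑ n (λ u → + ⌊ ⌊ p / u ⌋ / r ⌋))   ≡⟨ ∑-comm n n _ ⟩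
    ∑ n (λ u → ∑ n (λ r → + ⌊ ⌊ p / u ⌋ / r ⌋))   ≤⟨ ∑-mono-≤ n (λ u _ _ → ∑-⌊M/r⌋≤ L n ⌊ p / u ⌋ n<2^L) ⟩
    ∑ n (λ u → + (⌊ p / u ⌋ ℕ.* L))              ≡⟨ trans (∑-cong n (λ u _ _ → pos-* ⌊ p / u ⌋ L)) (∑-*ʳ n (+ L) _) ⟩
    ∑ n (λ u → + ⌊ p / u ⌋) * + L                ≤⟨ *-monoʳ-≤-nonNeg (+ L) (∑-⌊M/r⌋≤ L n p n<2^L) ⟩
    + (p ℕ.* L) * + L                            ∎
    where
    open ≤-Reasoning
    p L : ℕ
    p = suc n
    L = suc ⌊log₂ p ⌋
    n<2^L : n ℕ.< 2 ^ L
    n<2^L = ℕP.<-trans (ℕP.n<1+n n) (n<2^[1+⌊log₂n⌋] p)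

  -- The sum S₃(d)

  ∑-τ≡0 : ∀ n → ∑ n (τ (suc n)) ≡ 0ℤ
  ∑-τ≡0 n = begin
    ∑ n (τ (suc n))                                  ≡⟨ ∑-distrib-- n (λ x → + 2 * + x) (λ _ → + suc n) ⟩
    ∑ n (λ x → + 2 * + x) - ∑ n (λ _ → + suc n)      ≡⟨ cong₂ _-_ (trans (∑-*ˡ n (+ 2) (λ x → + x)) (∑-id n)) (∑-const n (+ suc n)) ⟩
    + n * (+ n + 1ℤ) - + n * (1ℤ + + n)              ≡⟨ cancel (+ n) ⟩
    0ℤ                                               ∎
    where
    open ≡-Reasoning
    cancel : ∀ n → n * (n + 1ℤ) - n * (1ℤ + n) ≡ 0ℤ
    cancel = solve-∀

  ∣τ∣≤3k : ∀ k x → x ℕ.≤ k → ∣ τ k x ∣ ℕ.≤ 3 ℕ.* k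
  ∣τ∣≤3k k x x≤k = ℕP.≤-trans (∣i-j∣≤∣i∣+∣j∣ (+ 2 * + x) (+ k))
    (ℕP.≤-trans (ℕP.+-monoˡ-≤ k (ℕP.≤-trans (ℕP.≤-reflexive (abs-* (+ 2) (+ x))) (ℕP.*-monoʳ-≤ 2 x≤k))) (ℕP.≤-reflexive (ℕP.+-comm (2 ℕ.* k) k)))

  module CubicSum (m : ℕ) (pr : Prime (2 ℕ.+ m)) (d : ℤ) (p∤d : ¬ (+ (2 ℕ.+ m) ℤU.∣ d)) where
    open PrimeModulus m pr

    d̄ : ℕ
    d̄ = d %ℕ p

    d̄≤n : d̄ ℕ.≤ n
    d̄≤n = ℕP.≤-pred (n%ℕd<d d p)

    d≡d̄+[d/p]p : d ≡ + d̄ + (d /ℕ p) * P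
    d≡d̄+[d/p]p = a≡a%ℕn+[a/ℕn]*n d p

    x-d≡x-d̄-[d/p]p : ∀ x → + x - d ≡ (+ x - + d̄) - (d /ℕ p) * P
    x-d≡x-d̄-[d/p]p x = trans (cong (λ z → + x - z) d≡d̄+[d/p]p) (regroup (+ x) (+ d̄) ((d /ℕ p) * P))
      where
      regroup : ∀ x r s → x - (r + s) ≡ (x - r) - s
      regroup = solve-∀

    d̄≥1 : 1 ℕ.≤ d̄
    d̄≥1 with d̄ in eq
    ... | suc _ = s≤s z≤n
    ... | zero  = ⊥-elim (p∤d (∣⇒∣ᵤ (subst (P ℤD.∣_) (sym d≡[d/p]p) (∣n⇒∣m*n (d /ℕ p) ℤD.∣-refl))))
      where
      d≡[d/p]p : d ≡ (d /ℕ p) * P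
      d≡[d/p]p = trans d≡d̄+[d/p]p (trans (cong (λ z → + z + (d /ℕ p) * P) eq) (+-identityˡ ((d /ℕ p) * P)))

    𝟙[p∣x-d]≡𝟙[x%p≡d̄] : ∀ x → 𝟙 (p ℕD.∣? ∣ + x - d ∣) ≡ 𝟙 (x % p ℕ.≟ d̄)
    𝟙[p∣x-d]≡𝟙[x%p≡d̄] x = 𝟙-cong (p ℕD.∣? ∣ + x - d ∣) (x % p ℕ.≟ d̄) to from
      where
      to : p ℕD.∣ ∣ + x - d ∣ → x % p ≡ d̄
      to p∣x-d = trans (∣⇒%p-cong x d̄ (subst (P ℤD.∣_) restore (∣m∣n⇒∣m+n {m = + x - d} (∣ᵤ⇒∣ p∣x-d) (∣n⇒∣m*n (d /ℕ p) ℤD.∣-refl))))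
                       (m<n⇒m%n≡m (s≤s d̄≤n))
        where
        sub-add : ∀ u v → (u - v) + v ≡ u
        sub-add = solve-∀
        restore : (+ x - d) + (d /ℕ p) * P ≡ + x - + d̄
        restore = trans (cong (_+ (d /ℕ p) * P) (x-d≡x-d̄-[d/p]p x)) (sub-add (+ x - + d̄) ((d /ℕ p) * P))
      from : x % p ≡ d̄ → p ℕD.∣ ∣ + x - d ∣
      from x≡d̄ = ∣⇒∣ᵤ (subst (P ℤD.∣_) (sym (x-d≡x-d̄-[d/p]p x))
        (∣m∣n⇒∣m-n (%p-cong⇒∣ x d̄ (trans x≡d̄ (sym (m<n⇒m%n≡m (s≤s d̄≤n))))) (∣n⇒∣m*n (d /ℕ p) ℤD.∣-refl)))

    χ : ℕ → ℕ → ℕ → ℤ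
    χ a b c = 𝟙 ((a ℕ.* b ℕ.* c) % p ℕ.≟ d̄)

    Σχ : (ℕ → ℕ → ℕ → ℤ) → ℤ
    Σχ F = ∑ n (λ a → ∑ n (λ b → ∑ n (λ c → χ a b c * F a b c)))

    S3≡Σχabc : + S3 p d ≡ Σχ (λ a b c → + a * + b * + c)
    S3≡Σχabc = trans (sum-applyUpTo n _) (∑-cong n (λ a _ _ → trans (sum-applyUpTo n _)
                 (∑-cong n (λ b _ _ → trans (sum-applyUpTo n _) (∑-cong n (λ c _ _ → term a b c))))))
      where
      term : ∀ a b c → + (if does (p ℕD.∣? ∣ + (a ℕ.* b ℕ.* c) - d ∣) then a ℕ.* b ℕ.* c else 0) ≡ χ a b c * (+ a * + b * + c)
      term a b c = trans (if-does≡𝟙* (p ℕD.∣? ∣ + (a ℕ.* b ℕ.* c) - d ∣) (a ℕ.* b ℕ.* c))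
        (cong₂ _*_ (𝟙[p∣x-d]≡𝟙[x%p≡d̄] (a ℕ.* b ℕ.* c)) (trans (pos-* (a ℕ.* b) c) (cong (_* + c) (pos-* a b))))

    ∑-𝟙[hx≡d̄] : ∀ h → 1 ℕ.≤ h % p → ∑ n (λ x → 𝟙 ((h ℕ.* x) % p ℕ.≟ d̄)) ≡ 1ℤ
    ∑-𝟙[hx≡d̄] h 1≤h%p = trans (∑-cong n (λ x _ _ → cong (λ z → 𝟙 (z ℕ.≟ d̄)) (sym ([[m%o]*n]%o≡[m*n]%o h x p))))
                               (∑-𝟙[hc≡t] (h % p) d̄ 1≤h%p (%p≤n h) d̄≥1 d̄≤n)

    ∑χ-c : ∀ a b → 1 ℕ.≤ a → a ℕ.≤ n → 1 ℕ.≤ b → b ℕ.≤ n → ∑ n (λ c → χ a b c) ≡ 1ℤ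
    ∑χ-c a b 1≤a a≤n 1≤b b≤n = ∑-𝟙[hx≡d̄] (a ℕ.* b) ([h*x]%p≥1 a b 1≤a a≤n 1≤b b≤n)

    ∑χ-b : ∀ a c → 1 ℕ.≤ a → a ℕ.≤ n → 1 ℕ.≤ c → c ℕ.≤ n → ∑ n (λ b → χ a b c) ≡ 1ℤ
    ∑χ-b a c 1≤a a≤n 1≤c c≤n = trans (∑-cong n (λ b _ _ → cong (λ z → 𝟙 (z % p ℕ.≟ d̄)) (swap a b c)))
                                     (∑-𝟙[hx≡d̄] (a ℕ.* c) ([h*x]%p≥1 a c 1≤a a≤n 1≤c c≤n))
      where
      swap : ∀ a b c → a ℕ.* b ℕ.* c ≡ a ℕ.* c ℕ.* b
      swap = ℕSolver.solve-∀

    ∑χ-a : ∀ b c → 1 ℕ.≤ b → b ℕ.≤ n → 1 ℕ.≤ c → c ℕ.≤ n → ∑ n (λ a → χ a b c) ≡ 1ℤ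
    ∑χ-a b c 1≤b b≤n 1≤c c≤n = trans (∑-cong n (λ a _ _ → cong (λ z → 𝟙 (z % p ℕ.≟ d̄)) (rotate a b c)))
                                     (∑-𝟙[hx≡d̄] (b ℕ.* c) ([h*x]%p≥1 b c 1≤b b≤n 1≤c c≤n))
      where
      rotate : ∀ a b c → a ℕ.* b ℕ.* c ≡ b ℕ.* c ℕ.* a
      rotate = ℕSolver.solve-∀

    Σχ-cong : ∀ {F G : ℕ → ℕ → ℕ → ℤ} → (∀ a b c → F a b c ≡ G a b c) → Σχ F ≡ Σχ G
    Σχ-cong F≡G = ∑-cong n (λ a _ _ → ∑-cong n (λ b _ _ → ∑-cong n (λ c _ _ → cong (χ a b c *_) (F≡G a b c))))

    Σχ-+ : ∀ (F G : ℕ → ℕ → ℕ → ℤ) → Σχ (λ a b c → F a b c + G a b c) ≡ Σχ F + Σχ G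
    Σχ-+ F G = trans (∑-cong n (λ a _ _ → trans (∑-cong n (λ b _ _ → trans (∑-cong n (λ c _ _ → *-distribˡ-+ (χ a b c) (F a b c) (G a b c)))
                 (∑-distrib-+ n _ _))) (∑-distrib-+ n _ _))) (∑-distrib-+ n _ _)

    Σχ-*ˡ : ∀ k (F : ℕ → ℕ → ℕ → ℤ) → Σχ (λ a b c → k * F a b c) ≡ k * Σχ F
    Σχ-*ˡ k F = trans (∑-cong n (λ a _ _ → trans (∑-cong n (λ b _ _ → trans (∑-cong n (λ c _ _ → rearrange (χ a b c) k (F a b c)))
                  (∑-*ˡ n k _))) (∑-*ˡ n k _))) (∑-*ˡ n k _)
      where
      rearrange : ∀ e k f → e * (k * f) ≡ k * (e * f)
      rearrange = solve-∀

    Σχ-ab : ∀ (g : ℕ → ℕ → ℤ) → Σχ (λ a b c → g a b) ≡ ∑ n (λ a → ∑ n (λ b → g a b))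
    Σχ-ab g = ∑-cong n (λ a 1≤a a≤n → ∑-cong n (λ b 1≤b b≤n →
                trans (∑-*ʳ n (g a b) (χ a b)) (trans (cong (_* g a b) (∑χ-c a b 1≤a a≤n 1≤b b≤n)) (*-identityˡ (g a b)))))

    Σχ-ac : ∀ (g : ℕ → ℕ → ℤ) → Σχ (λ a b c → g a c) ≡ ∑ n (λ a → ∑ n (λ c → g a c))
    Σχ-ac g = ∑-cong n (λ a 1≤a a≤n → trans (∑-comm n n (λ b c → χ a b c * g a c)) (∑-cong n (λ c 1≤c c≤n →
                trans (∑-*ʳ n (g a c) (λ b → χ a b c)) (trans (cong (_* g a c) (∑χ-b a c 1≤a a≤n 1≤c c≤n)) (*-identityˡ (g a c))))))

    Σχ-bc : ∀ (g : ℕ → ℕ → ℤ) → Σχ (λ a b c → g b c) ≡ ∑ n (λ b → ∑ n (λ c → g b c))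
    Σχ-bc g = trans (∑-comm n n (λ a b → ∑ n (λ c → χ a b c * g b c))) (∑-cong n (λ b 1≤b b≤n →
                trans (∑-comm n n (λ a c → χ a b c * g b c)) (∑-cong n (λ c 1≤c c≤n →
                  trans (∑-*ʳ n (g b c) (λ a → χ a b c)) (trans (cong (_* g b c) (∑χ-a b c 1≤b b≤n 1≤c c≤n)) (*-identityˡ (g b c)))))))

    t : ℕ → ℤ
    t = τ p

    W : ℤ
    W = Σχ (λ a b c → t a * t b * t c)

    ∑-k*t≡0 : ∀ k → ∑ n (λ c → k * t c) ≡ 0ℤ
    ∑-k*t≡0 k = trans (∑-*ˡ n k t) (trans (cong (k *_) (∑-τ≡0 n)) (*-zeroʳ k))

    -- Writing 2x = p + t x, the products that contain a lone factor t c average out.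
    8S3≡ : + 8 * + S3 p d ≡ P * (+ n * P) * (+ n * P) + W
    8S3≡ = begin
      + 8 * + S3 p d
        ≡⟨ cong (λ z → + 8 * z) S3≡Σχabc ⟩
      + 8 * Σχ (λ a b c → + a * + b * + c)
        ≡⟨ Σχ-*ˡ (+ 8) _ ⟨
      Σχ (λ a b c → + 8 * (+ a * + b * + c))
        ≡⟨ Σχ-cong (λ a b c → expand P (+ a) (+ b) (+ c)) ⟩
      Σχ (λ a b c → g a b + (P * P * t c + (P * (t a * t c) + (P * (t b * t c) + t a * t b * t c))))
        ≡⟨ trans (Σχ-+ (λ a b c → g a b) (λ a b c → ppt a b c + (pac a b c + (pbc a b c + ttt a b c))))
            (cong (λ z → Σχ (λ a b c → g a b) + z) (trans (Σχ-+ ppt (λ a b c → pac a b c + (pbc a b c + ttt a b c)))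
              (cong₂ _+_ Σχ-ppt (trans (Σχ-+ pac (λ a b c → pbc a b c + ttt a b c))
                (cong₂ _+_ Σχ-pac (trans (Σχ-+ pbc ttt) (cong (_+ W) Σχ-pbc))))))) ⟩
      Σχ (λ a b c → g a b) + (0ℤ + (0ℤ + (0ℤ + W)))
        ≡⟨ cong₂ _+_ Σχ-g (trans (+-identityˡ _) (trans (+-identityˡ _) (+-identityˡ W))) ⟩
      P * (+ n * P) * (+ n * P) + W ∎
      where
      open ≡-Reasoning
      g : ℕ → ℕ → ℤ
      g a b = (P + t a) * ((P + t b) * P)
      ppt pac pbc ttt : ℕ → ℕ → ℕ → ℤ
      ppt a b c = P * P * t c
      pac a b c = P * (t a * t c)
      pbc a b c = P * (t b * t c)
      ttt a b c = t a * t b * t c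
      expand : ∀ p a b c → + 8 * (a * b * c) ≡
        (p + (+ 2 * a - p)) * ((p + (+ 2 * b - p)) * p) + (p * p * (+ 2 * c - p) + (p * ((+ 2 * a - p) * (+ 2 * c - p)) +
        (p * ((+ 2 * b - p) * (+ 2 * c - p)) + (+ 2 * a - p) * (+ 2 * b - p) * (+ 2 * c - p))))
      expand = solve-∀
      ∑[p+t]≡np : ∑ n (λ x → P + t x) ≡ + n * P
      ∑[p+t]≡np = trans (∑-distrib-+ n (λ _ → P) t) (trans (cong₂ _+_ (∑-const n P) (∑-τ≡0 n)) (+-identityʳ (+ n * P)))
      Σχ-g : Σχ (λ a b c → g a b) ≡ P * (+ n * P) * (+ n * P)
      Σχ-g = trans (Σχ-ab g) (trans (∑-*-∑ n n (λ a → P + t a) (λ b → (P + t b) * P))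
               (trans (cong₂ _*_ ∑[p+t]≡np (trans (∑-*ʳ n P (λ b → P + t b)) (cong (_* P) ∑[p+t]≡np))) (reorder (+ n) P)))
        where
        reorder : ∀ n p → (n * p) * ((n * p) * p) ≡ p * (n * p) * (n * p)
        reorder = solve-∀
      Σχ-ppt : Σχ ppt ≡ 0ℤ
      Σχ-ppt = trans (Σχ-ac (λ a c → P * P * t c)) (trans (∑-cong n (λ a _ _ → ∑-k*t≡0 (P * P))) (∑-zero n))
      Σχ-pac : Σχ pac ≡ 0ℤ
      Σχ-pac = trans (Σχ-ac (λ a c → P * (t a * t c))) (trans (∑-cong n (λ a _ _ →
                   trans (∑-cong n (λ c _ _ → sym (*-assoc P (t a) (t c)))) (∑-k*t≡0 (P * t a)))) (∑-zero n))
      Σχ-pbc : Σχ pbc ≡ 0ℤ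
      Σχ-pbc = trans (Σχ-bc (λ b c → P * (t b * t c))) (trans (∑-cong n (λ b _ _ →
                   trans (∑-cong n (λ c _ _ → sym (*-assoc P (t b) (t c)))) (∑-k*t≡0 (P * t b)))) (∑-zero n))

    F : ℕ → ℤ
    F c = ∑ n (λ a → ∑ n (λ b → χ a b c * (t a * t b)))

    W≡∑tF : W ≡ ∑ n (λ c → t c * F c)
    W≡∑tF = begin
      ∑ n (λ a → ∑ n (λ b → ∑ n (λ c → χ a b c * (t a * t b * t c))))  ≡⟨ ∑-cong n (λ a _ _ → ∑-comm n n _) ⟩
      ∑ n (λ a → ∑ n (λ c → ∑ n (λ b → χ a b c * (t a * t b * t c))))  ≡⟨ ∑-comm n n _ ⟩
      ∑ n (λ c → ∑ n (λ a → ∑ n (λ b → χ a b c * (t a * t b * t c))))  ≡⟨ ∑-cong n (λ c _ _ → factor c) ⟩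
      ∑ n (λ c → t c * F c)                                            ∎
      where
      open ≡-Reasoning
      pull : ∀ e x y z → e * (x * y * z) ≡ z * (e * (x * y))
      pull = solve-∀
      factor : ∀ c → ∑ n (λ a → ∑ n (λ b → χ a b c * (t a * t b * t c))) ≡ t c * F c
      factor c = trans (∑-cong n (λ a _ _ → trans (∑-cong n (λ b _ _ → pull (χ a b c) (t a) (t b) (t c))) (∑-*ˡ n (t c) _))) (∑-*ˡ n (t c) _)

    W²≤ : W * W ≤ ∑ n (λ c → t c * t c) * ∑ n (λ c → F c * F c)
    W²≤ = subst (λ z → z * z ≤ ∑ n (λ c → t c * t c) * ∑ n (λ c → F c * F c)) (sym W≡∑tF) (cauchy-schwarz n t F)

    μ : ℕ → ℕ → ℕ
    μ a a′ = (inverse a′ ℕ.* a) % p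

    -- The c-sum of χ a b c χ a′ b′ c detects a b ≡ a′ b′, and then b′ ≡ μ a a′ b.
    ∑F²≡∑D : ∑ n (λ c → F c * F c) ≡ ∑ n (λ a → ∑ n (λ a′ → (t a * t a′) * D (μ a a′) n))
    ∑F²≡∑D = begin
      ∑ n (λ c → F c * F c)
        ≡⟨ ∑-cong n (λ c _ _ → square c) ⟩
      ∑ n (λ c → ∑ n (λ a → ∑ n (λ a′ → ∑ n (λ b → ∑ n (λ b′ → X a a′ b b′ c)))))
        ≡⟨ c-innermost ⟩
      ∑ n (λ a → ∑ n (λ a′ → ∑ n (λ b → ∑ n (λ b′ → ∑ n (λ c → X a a′ b b′ c)))))
        ≡⟨ ∑-cong n (λ a 1≤a a≤n → ∑-cong n (λ a′ 1≤a′ a′≤n → pair a a′ 1≤a a≤n 1≤a′ a′≤n)) ⟩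
      ∑ n (λ a → ∑ n (λ a′ → (t a * t a′) * D (μ a a′) n)) ∎
      where
      open ≡-Reasoning
      X : ℕ → ℕ → ℕ → ℕ → ℕ → ℤ
      X a a′ b b′ c = (χ a b c * (t a * t b)) * (χ a′ b′ c * (t a′ * t b′))
      square : ∀ c → F c * F c ≡ ∑ n (λ a → ∑ n (λ a′ → ∑ n (λ b → ∑ n (λ b′ → X a a′ b b′ c))))
      square c = sym (trans (∑-cong n (λ a _ _ → ∑-cong n (λ a′ _ _ → ∑-*-∑ n n _ _))) (∑-*-∑ n n _ _))
      c-innermost : ∑ n (λ c → ∑ n (λ a → ∑ n (λ a′ → ∑ n (λ b → ∑ n (λ b′ → X a a′ b b′ c))))) ≡
                    ∑ n (λ a → ∑ n (λ a′ → ∑ n (λ b → ∑ n (λ b′ → ∑ n (λ c → X a a′ b b′ c)))))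
      c-innermost = trans (∑-comm n n _) (∑-cong n (λ a _ _ → trans (∑-comm n n _) (∑-cong n (λ a′ _ _ →
                      trans (∑-comm n n _) (∑-cong n (λ b _ _ → ∑-comm n n _))))))
      χ≡ : ∀ a b c → χ a b c ≡ 𝟙 ((((a ℕ.* b) % p) ℕ.* c) % p ℕ.≟ d̄)
      χ≡ a b c = cong (λ z → 𝟙 (z ℕ.≟ d̄)) (sym ([[m%o]*n]%o≡[m*n]%o (a ℕ.* b) c p))
      regroup : ∀ e e′ x y x′ y′ → (e * (x * y)) * (e′ * (x′ * y′)) ≡ (e * e′) * ((x * x′) * (y * y′))
      regroup = solve-∀
      shuffle : ∀ i x x′ y y′ → i * ((x * x′) * (y * y′)) ≡ (x * x′) * (y * (y′ * i))
      shuffle = solve-∀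
      sum-c : ∀ a a′ b b′ → 1 ℕ.≤ a → a ℕ.≤ n → 1 ℕ.≤ a′ → a′ ℕ.≤ n → 1 ℕ.≤ b → b ℕ.≤ n → 1 ℕ.≤ b′ → b′ ℕ.≤ n →
        ∑ n (λ c → X a a′ b b′ c) ≡ (t a * t a′) * (t b * (t b′ * 𝟙 ((a′ ℕ.* b′) % p ℕ.≟ (a ℕ.* b) % p)))
      sum-c a a′ b b′ 1≤a a≤n 1≤a′ a′≤n 1≤b b≤n 1≤b′ b′≤n = begin
        ∑ n (λ c → X a a′ b b′ c)
          ≡⟨ trans (∑-cong n (λ c _ _ → regroup (χ a b c) (χ a′ b′ c) (t a) (t b) (t a′) (t b′))) (∑-*ʳ n _ (λ c → χ a b c * χ a′ b′ c)) ⟩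
        ∑ n (λ c → χ a b c * χ a′ b′ c) * ((t a * t a′) * (t b * t b′))
          ≡⟨ cong (_* ((t a * t a′) * (t b * t b′))) (trans (∑-cong n (λ c _ _ → cong₂ _*_ (χ≡ a b c) (χ≡ a′ b′ c)))
               (∑-𝟙[hc≡t]𝟙[h′c≡t] ((a ℕ.* b) % p) ((a′ ℕ.* b′) % p) d̄ ([h*x]%p≥1 a b 1≤a a≤n 1≤b b≤n) (%p≤n (a ℕ.* b)) (%p≤n (a′ ℕ.* b′)) d̄≥1 d̄≤n)) ⟩
        𝟙 ((a ℕ.* b) % p ℕ.≟ (a′ ℕ.* b′) % p) * ((t a * t a′) * (t b * t b′))
          ≡⟨ cong (_* ((t a * t a′) * (t b * t b′))) (𝟙-cong ((a ℕ.* b) % p ℕ.≟ (a′ ℕ.* b′) % p) ((a′ ℕ.* b′) % p ℕ.≟ (a ℕ.* b) % p) sym sym) ⟩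
        𝟙 ((a′ ℕ.* b′) % p ℕ.≟ (a ℕ.* b) % p) * ((t a * t a′) * (t b * t b′))
          ≡⟨ shuffle _ (t a) (t a′) (t b) (t b′) ⟩
        (t a * t a′) * (t b * (t b′ * 𝟙 ((a′ ℕ.* b′) % p ℕ.≟ (a ℕ.* b) % p))) ∎
      μ-step : ∀ a a′ b → (inverse a′ ℕ.* ((a ℕ.* b) % p)) % p ≡ (μ a a′ ℕ.* b) % p
      μ-step a a′ b = begin
        (inverse a′ ℕ.* ((a ℕ.* b) % p)) % p   ≡⟨ [m*[n%o]]%o≡[m*n]%o (inverse a′) (a ℕ.* b) p ⟩
        (inverse a′ ℕ.* (a ℕ.* b)) % p         ≡⟨ cong (_% p) (ℕP.*-assoc (inverse a′) a b) ⟨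
        (inverse a′ ℕ.* a ℕ.* b) % p           ≡⟨ [[m%o]*n]%o≡[m*n]%o (inverse a′ ℕ.* a) b p ⟨
        (μ a a′ ℕ.* b) % p                     ∎
      pair : ∀ a a′ → 1 ℕ.≤ a → a ℕ.≤ n → 1 ℕ.≤ a′ → a′ ℕ.≤ n →
        ∑ n (λ b → ∑ n (λ b′ → ∑ n (λ c → X a a′ b b′ c))) ≡ (t a * t a′) * D (μ a a′) n
      pair a a′ 1≤a a≤n 1≤a′ a′≤n = begin
        ∑ n (λ b → ∑ n (λ b′ → ∑ n (λ c → X a a′ b b′ c)))
          ≡⟨ ∑-cong n (λ b 1≤b b≤n → ∑-cong n (λ b′ 1≤b′ b′≤n → sum-c a a′ b b′ 1≤a a≤n 1≤a′ a′≤n 1≤b b≤n 1≤b′ b′≤n)) ⟩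
        ∑ n (λ b → ∑ n (λ b′ → (t a * t a′) * (t b * (t b′ * I b b′))))
          ≡⟨ trans (∑-cong n (λ b _ _ → trans (∑-*ˡ n (t a * t a′) _) (cong ((t a * t a′) *_) (∑-*ˡ n (t b) _)))) (∑-*ˡ n (t a * t a′) _) ⟩
        (t a * t a′) * ∑ n (λ b → t b * ∑ n (λ b′ → t b′ * I b b′))
          ≡⟨ cong ((t a * t a′) *_) (∑-cong n (λ b 1≤b b≤n → cong (t b *_)
               (trans (∑-select a′ ((a ℕ.* b) % p) t 1≤a′ a′≤n ([h*x]%p≥1 a b 1≤a a≤n 1≤b b≤n) (%p≤n (a ℕ.* b))) (cong t (μ-step a a′ b))))) ⟩
        (t a * t a′) * D (μ a a′) n ∎
        where
        I : ℕ → ℕ → ℤ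
        I b b′ = 𝟙 ((a′ ℕ.* b′) % p ℕ.≟ (a ℕ.* b) % p)

    L : ℕ
    L = ⌊log₂ p ⌋

    1≤L : 1 ℕ.≤ L
    1≤L = subst (ℕ._≤ L) (⌊log₂[2^n]⌋≡n 1) (⌊log₂⌋-mono-≤ {2} {p} (s≤s (s≤s z≤n)))

    Σ∣D∣ : ℤ
    Σ∣D∣ = ∑ n (λ ℓ → + ∣ D ℓ n ∣)

    Σ∣D∣≤ : Σ∣D∣ ≤ + (32 ℕ.* (p ℕ.* p ℕ.* p) ℕ.* (L ℕ.* L))
    Σ∣D∣≤ = begin
      Σ∣D∣
        ≤⟨ DedekindSumAverage.∑∣D∣≤ m pr ⟩
      + (4 ℕ.* (p ℕ.* p)) * (+ 2 * ∑ n (λ r → ∑ n (λ u → + EuclideanBound.Q p u r)))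
        ≤⟨ *-monoˡ-≤-nonNeg (+ (4 ℕ.* (p ℕ.* p))) (*-monoˡ-≤-nonNeg (+ 2) (∑∑Q≤ n)) ⟩
      + (4 ℕ.* (p ℕ.* p)) * (+ 2 * (+ (p ℕ.* suc L) * + suc L))
        ≡⟨ cong (λ z → + (4 ℕ.* (p ℕ.* p)) * z) (cong (λ z → + 2 * z) (sym (pos-* (p ℕ.* suc L) (suc L)))) ⟩
      + (4 ℕ.* (p ℕ.* p)) * (+ 2 * + (p ℕ.* suc L ℕ.* suc L))
        ≡⟨ cong (λ z → + (4 ℕ.* (p ℕ.* p)) * z) (sym (pos-* 2 (p ℕ.* suc L ℕ.* suc L))) ⟩
      + (4 ℕ.* (p ℕ.* p)) * + (2 ℕ.* (p ℕ.* suc L ℕ.* suc L))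
        ≡⟨ sym (pos-* (4 ℕ.* (p ℕ.* p)) (2 ℕ.* (p ℕ.* suc L ℕ.* suc L))) ⟩
      + (4 ℕ.* (p ℕ.* p) ℕ.* (2 ℕ.* (p ℕ.* suc L ℕ.* suc L)))
        ≤⟨ +≤+ (ℕP.≤-trans (ℕP.*-monoʳ-≤ (4 ℕ.* (p ℕ.* p)) (ℕP.*-monoʳ-≤ 2 (ℕP.*-mono-≤ (ℕP.*-monoʳ-≤ p 1+L≤2L) 1+L≤2L)))
                           (ℕP.≤-reflexive (collect p L))) ⟩
      + (32 ℕ.* (p ℕ.* p ℕ.* p) ℕ.* (L ℕ.* L)) ∎
      where
      open ≤-Reasoning
      1+L≤2L : suc L ℕ.≤ 2 ℕ.* L
      1+L≤2L = ℕP.≤-trans (ℕP.+-monoˡ-≤ L 1≤L) (ℕP.≤-reflexive (cong (L ℕ.+_) (sym (ℕP.+-identityʳ L))))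
      collect : ∀ p L → 4 ℕ.* (p ℕ.* p) ℕ.* (2 ℕ.* (p ℕ.* (2 ℕ.* L) ℕ.* (2 ℕ.* L))) ≡ 32 ℕ.* (p ℕ.* p ℕ.* p) ℕ.* (L ℕ.* L)
      collect = ℕSolver.solve-∀

    ∣t∣≤3p : ∀ x → x ℕ.≤ n → ∣ t x ∣ ℕ.≤ 3 ℕ.* p
    ∣t∣≤3p x x≤n = ∣τ∣≤3k p x (ℕP.m≤n⇒m≤1+n x≤n)

    ∑t²≤ : ∑ n (λ c → t c * t c) ≤ + n * + (3 ℕ.* p ℕ.* (3 ℕ.* p))
    ∑t²≤ = ≤-trans (∑-mono-≤ n (λ c _ c≤n → subst (_≤ + (3 ℕ.* p ℕ.* (3 ℕ.* p))) (sym (i*i≡∣i∣*∣i∣ (t c)))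
                     (+≤+ (ℕP.*-mono-≤ (∣t∣≤3p c c≤n) (∣t∣≤3p c c≤n)))))
                   (≤-reflexive (∑-const n _))

    ∑F²≤ : ∑ n (λ c → F c * F c) ≤ + n * (+ (3 ℕ.* p ℕ.* (3 ℕ.* p)) * Σ∣D∣)
    ∑F²≤ = begin
      ∑ n (λ c → F c * F c)                                         ≡⟨ ∑F²≡∑D ⟩
      ∑ n (λ a → ∑ n (λ a′ → (t a * t a′) * D (μ a a′) n))
        ≤⟨ ∑-mono-≤ n (λ a _ a≤n → ∑-mono-≤ n (λ a′ _ a′≤n → term≤ a a′ a≤n a′≤n)) ⟩
      ∑ n (λ a → ∑ n (λ a′ → + 9p² * + ∣ D (μ a a′) n ∣))
        ≡⟨ ∑-comm n n _ ⟩
      ∑ n (λ a′ → ∑ n (λ a → + 9p² * + ∣ D (μ a a′) n ∣))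
        ≡⟨ ∑-cong n (λ a′ 1≤a′ a′≤n → trans (∑-*ˡ n (+ 9p²) _) (cong (λ z → + 9p² * z)
             (∑-permute (inverse a′) (inverse≥1 a′ 1≤a′ a′≤n) (inverse≤n a′) (λ z → + ∣ D z n ∣)))) ⟩
      ∑ n (λ a′ → + 9p² * Σ∣D∣)
        ≡⟨ ∑-const n _ ⟩
      + n * (+ 9p² * Σ∣D∣) ∎
      where
      open ≤-Reasoning
      9p² : ℕ
      9p² = 3 ℕ.* p ℕ.* (3 ℕ.* p)
      i≤+∣i∣ : ∀ i → i ≤ + ∣ i ∣
      i≤+∣i∣ (+ k)    = ≤-refl
      i≤+∣i∣ -[1+ k ] = ℤ.-≤+
      term≤ : ∀ a a′ → a ℕ.≤ n → a′ ℕ.≤ n → (t a * t a′) * D (μ a a′) n ≤ + 9p² * + ∣ D (μ a a′) n ∣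
      term≤ a a′ a≤n a′≤n = ≤-trans (i≤+∣i∣ _) (≤-trans (+≤+ (ℕP.≤-trans
        (ℕP.≤-reflexive (trans (abs-* (t a * t a′) (D (μ a a′) n)) (cong (ℕ._* ∣ D (μ a a′) n ∣) (abs-* (t a) (t a′)))))
        (ℕP.*-monoˡ-≤ ∣ D (μ a a′) n ∣ (ℕP.*-mono-≤ (∣t∣≤3p a a≤n) (∣t∣≤3p a′ a′≤n))))) (≤-reflexive (pos-* 9p² ∣ D (μ a a′) n ∣)))

    σ K y : ℕ
    σ = 32 ℕ.* (p ℕ.* p ℕ.* p) ℕ.* (L ℕ.* L)
    K = n ℕ.* (3 ℕ.* p ℕ.* (3 ℕ.* p)) ℕ.* (n ℕ.* (3 ℕ.* p ℕ.* (3 ℕ.* p) ℕ.* σ))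
    y = p ℕ.* p ℕ.* p ℕ.* (2 ℕ.* n ℕ.+ 1)

    W²≤K : W * W ≤ + K
    W²≤K = begin
      W * W
        ≤⟨ W²≤ ⟩
      ∑ n (λ c → t c * t c) * ∑ n (λ c → F c * F c)
        ≤⟨ *-mono-≤-nonNeg (∑-nonNeg n (λ c _ _ → i*i≥0 (t c))) (∑-nonNeg n (λ c _ _ → i*i≥0 (F c)))
             ∑t²≤ (≤-trans ∑F²≤ (*-monoˡ-≤-nonNeg (+ n) (*-monoˡ-≤-nonNeg (+ 9p²) Σ∣D∣≤))) ⟩
      (+ n * + 9p²) * (+ n * (+ 9p² * + σ))
        ≡⟨ cong₂ _*_ (sym (pos-* n 9p²)) (trans (cong (λ z → + n * z) (sym (pos-* 9p² σ))) (sym (pos-* n (9p² ℕ.* σ)))) ⟩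
      + (n ℕ.* 9p²) * + (n ℕ.* (9p² ℕ.* σ))
        ≡⟨ sym (pos-* (n ℕ.* 9p²) (n ℕ.* (9p² ℕ.* σ))) ⟩
      + K ∎
      where
      open ≤-Reasoning
      9p² : ℕ
      9p² = 3 ℕ.* p ℕ.* (3 ℕ.* p)

    p⁵≡p³n²+y : p ^ 5 ≡ p ℕ.* p ℕ.* p ℕ.* (n ℕ.* n) ℕ.+ y
    p⁵≡p³n²+y = expand n
      where
      expand : ∀ n → (1 ℕ.+ n) ℕ.* ((1 ℕ.+ n) ℕ.* ((1 ℕ.+ n) ℕ.* ((1 ℕ.+ n) ℕ.* ((1 ℕ.+ n) ℕ.* 1)))) ≡
               (1 ℕ.+ n) ℕ.* (1 ℕ.+ n) ℕ.* (1 ℕ.+ n) ℕ.* (n ℕ.* n) ℕ.+ (1 ℕ.+ n) ℕ.* (1 ℕ.+ n) ℕ.* (1 ℕ.+ n) ℕ.* (2 ℕ.* n ℕ.+ 1)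
      expand = ℕSolver.solve-∀

    8S3-p⁵≡W-y : + (8 ℕ.* S3 p d) - + (p ^ 5) ≡ W - + y
    8S3-p⁵≡W-y = begin
      + (8 ℕ.* S3 p d) - + (p ^ 5)
        ≡⟨ cong₂ _-_ (trans (pos-* 8 (S3 p d)) 8S3≡) (trans (cong +_ p⁵≡p³n²+y) (pos-+ (p ℕ.* p ℕ.* p ℕ.* (n ℕ.* n)) y)) ⟩
      (P * (+ n * P) * (+ n * P) + W) - (+ (p ℕ.* p ℕ.* p ℕ.* (n ℕ.* n)) + + y)
        ≡⟨ cong (λ z → (P * (+ n * P) * (+ n * P) + W) - (z + + y)) p³n² ⟩
      (P * (+ n * P) * (+ n * P) + W) - (P * (+ n * P) * (+ n * P) + + y)
        ≡⟨ cancel (P * (+ n * P) * (+ n * P)) W (+ y) ⟩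
      W - + y ∎
      where
      open ≡-Reasoning
      cancel : ∀ a w y → (a + w) - (a + y) ≡ w - y
      cancel = solve-∀
      reorder : ∀ p n → (p * p * p) * (n * n) ≡ p * (n * p) * (n * p)
      reorder = solve-∀
      p³n² : + (p ℕ.* p ℕ.* p ℕ.* (n ℕ.* n)) ≡ P * (+ n * P) * (+ n * P)
      p³n² = trans (pos-* (p ℕ.* p ℕ.* p) (n ℕ.* n)) (trans (cong₂ _*_ (trans (pos-* (p ℕ.* p) p) (cong (_* P) (pos-* p p))) (pos-* n n)) (reorder P (+ n)))

    ∣8S3-p⁵∣²≤2y²+2K : ∣ + (8 ℕ.* S3 p d) - + (p ^ 5) ∣ ^ 2 ℕ.≤ 2 ℕ.* (y ℕ.* y) ℕ.+ 2 ℕ.* K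
    ∣8S3-p⁵∣²≤2y²+2K = drop‿+≤+ (begin
      + (∣ Z ∣ ^ 2)
        ≡⟨ cong +_ (cong (∣ Z ∣ ℕ.*_) (ℕP.*-identityʳ ∣ Z ∣)) ⟩
      + (∣ Z ∣ ℕ.* ∣ Z ∣)
        ≡⟨ i*i≡∣i∣*∣i∣ Z ⟨
      Z * Z
        ≡⟨ cong (λ z → z * z) 8S3-p⁵≡W-y ⟩
      (W - + y) * (W - + y)
        ≤⟨ i≤i+j _ ((W + + y) * (W + + y)) {{ℤ.nonNegative (i*i≥0 (W + + y))}} ⟩
      (W - + y) * (W - + y) + (W + + y) * (W + + y)
        ≡⟨ parallelogram W (+ y) ⟩
      + 2 * (+ y * + y) + + 2 * (W * W)
        ≤⟨ +-monoʳ-≤ (+ 2 * (+ y * + y)) (*-monoˡ-≤-nonNeg (+ 2) W²≤K) ⟩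
      + 2 * (+ y * + y) + + 2 * + K
        ≡⟨ cong₂ _+_ (trans (cong (λ z → + 2 * z) (sym (pos-* y y))) (sym (pos-* 2 (y ℕ.* y)))) (sym (pos-* 2 K)) ⟩
      + (2 ℕ.* (y ℕ.* y) ℕ.+ 2 ℕ.* K) ∎)
      where
      open ≤-Reasoning
      Z : ℤ
      Z = + (8 ℕ.* S3 p d) - + (p ^ 5)
      parallelogram : ∀ w y → (w - y) * (w - y) + (w + y) * (w + y) ≡ + 2 * (y * y) + + 2 * (w * w)
      parallelogram = solve-∀

    2y²+2K≤ : 2 ℕ.* (y ℕ.* y) ℕ.+ 2 ℕ.* K ℕ.≤ 5192 ℕ.* (p ^ 9 ℕ.* L ^ 4)
    2y²+2K≤ = begin
      2 ℕ.* (y ℕ.* y) ℕ.+ 2 ℕ.* K                 ≤⟨ ℕP.+-mono-≤ (ℕP.*-monoʳ-≤ 2 (ℕP.*-mono-≤ y≤2p⁴ y≤2p⁴)) (ℕP.*-monoʳ-≤ 2 K≤Kₚ) ⟩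
      2 ℕ.* (2p⁴ ℕ.* 2p⁴) ℕ.+ 2 ℕ.* Kₚ            ≡⟨ cong₂ ℕ._+_ (p⁸ p) (p⁹L² p L) ⟩
      8 ℕ.* p ^ 8 ℕ.+ 5184 ℕ.* (p ^ 9 ℕ.* L ^ 2)  ≤⟨ ℕP.+-mono-≤ (ℕP.*-monoʳ-≤ 8 p⁸≤p⁹L⁴) (ℕP.*-monoʳ-≤ 5184 (ℕP.*-monoʳ-≤ (p ^ 9) L²≤L⁴)) ⟩
      8 ℕ.* (p ^ 9 ℕ.* L ^ 4) ℕ.+ 5184 ℕ.* (p ^ 9 ℕ.* L ^ 4) ≡⟨ ℕP.*-distribʳ-+ (p ^ 9 ℕ.* L ^ 4) 8 5184 ⟨
      5192 ℕ.* (p ^ 9 ℕ.* L ^ 4)                  ∎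
      where
      open ℕP.≤-Reasoning
      2p⁴ : ℕ
      2p⁴ = p ℕ.* p ℕ.* p ℕ.* (2 ℕ.* p)
      y≤2p⁴ : y ℕ.≤ 2p⁴
      y≤2p⁴ = ℕP.*-monoʳ-≤ (p ℕ.* p ℕ.* p) (ℕP.≤-trans (ℕP.n≤1+n (2 ℕ.* n ℕ.+ 1)) (ℕP.≤-reflexive (double n)))
        where
        double : ∀ n → 1 ℕ.+ (2 ℕ.* n ℕ.+ 1) ≡ 2 ℕ.* (1 ℕ.+ n)
        double = ℕSolver.solve-∀
      p⁸ : ∀ p → 2 ℕ.* (p ℕ.* p ℕ.* p ℕ.* (2 ℕ.* p) ℕ.* (p ℕ.* p ℕ.* p ℕ.* (2 ℕ.* p))) ≡ 8 ℕ.* (p ℕ.* (p ℕ.* (p ℕ.* (p ℕ.* (p ℕ.* (p ℕ.* (p ℕ.* (p ℕ.* 1))))))))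
      p⁸ = ℕSolver.solve-∀
      Kₚ : ℕ
      Kₚ = p ℕ.* (3 ℕ.* p ℕ.* (3 ℕ.* p)) ℕ.* (p ℕ.* (3 ℕ.* p ℕ.* (3 ℕ.* p) ℕ.* σ))
      K≤Kₚ : K ℕ.≤ Kₚ
      K≤Kₚ = ℕP.*-mono-≤ (ℕP.*-monoˡ-≤ (3 ℕ.* p ℕ.* (3 ℕ.* p)) (ℕP.n≤1+n n)) (ℕP.*-monoˡ-≤ (3 ℕ.* p ℕ.* (3 ℕ.* p) ℕ.* σ) (ℕP.n≤1+n n))
      p⁹L² : ∀ p L → 2 ℕ.* (p ℕ.* (3 ℕ.* p ℕ.* (3 ℕ.* p)) ℕ.* (p ℕ.* (3 ℕ.* p ℕ.* (3 ℕ.* p) ℕ.* (32 ℕ.* (p ℕ.* p ℕ.* p) ℕ.* (L ℕ.* L))))) ≡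
                     5184 ℕ.* ((p ℕ.* (p ℕ.* (p ℕ.* (p ℕ.* (p ℕ.* (p ℕ.* (p ℕ.* (p ℕ.* (p ℕ.* 1))))))))) ℕ.* (L ℕ.* (L ℕ.* 1)))
      p⁹L² = ℕSolver.solve-∀
      p⁸≤p⁹L⁴ : p ^ 8 ℕ.≤ p ^ 9 ℕ.* L ^ 4
      p⁸≤p⁹L⁴ = ℕP.≤-trans (ℕP.≤-reflexive (sym (trans (ℕP.*-identityʳ (1 ℕ.* p ^ 8)) (ℕP.*-identityˡ (p ^ 8)))))
                  (ℕP.*-mono-≤ (ℕP.*-monoˡ-≤ (p ^ 8) (s≤s (z≤n {suc m}))) (ℕP.≤-trans (ℕP.≤-reflexive (sym (ℕP.^-zeroˡ 4))) (ℕP.^-monoˡ-≤ 4 1≤L)))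
      L²≤L⁴ : L ^ 2 ℕ.≤ L ^ 4
      L²≤L⁴ = ℕP.^-monoʳ-≤ L {{ℕ.>-nonZero 1≤L}} {2} {4} (s≤s (s≤s z≤n))

  ∣8S3-p⁵∣²≤ : ∀ p → Prime p → ∀ d → ¬ (+ p ℤU.∣ d) → ∣ + (8 ℕ.* S3 p d) - + (p ^ 5) ∣ ^ 2 ℕ.≤ 5192 ℕ.* (p ^ 9 ℕ.* ⌊log₂ p ⌋ ^ 4)
  ∣8S3-p⁵∣²≤ (suc (suc m)) pr d p∤d = ℕP.≤-trans ∣8S3-p⁵∣²≤2y²+2K 2y²+2K≤
    where open CubicSum m pr d p∤d
  ∣8S3-p⁵∣²≤ 0       pr with () ← prime⇒nonTrivial pr
  ∣8S3-p⁵∣²≤ 1       pr with () ← prime⇒nonTrivial pr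

open import Defs
open import Data.Nat using (ℕ; _*_; _^_; _≤_)
open import Data.Nat.Primality using (Prime)
open import Data.Nat.Logarithm using (⌊log₂_⌋)
open import Data.Integer using (ℤ; +_; _-_; ∣_∣)
open import Data.Integer.Divisibility using (_∣_)
open import Data.Product using (∃-syntax; _,_)
open import Relation.Nullary using (¬_)

theorem4 : ∃[ C ] ∀ (p : ℕ) → Prime p → ∀ (d : ℤ) → ¬ (+ p ∣ d) →
             ∣ + (8 * S3 p d) - + (p ^ 5) ∣ ^ 2 ≤ C * (p ^ 9 * ⌊log₂ p ⌋ ^ 4)
theorem4 = 5192 , S3-estimate.∣8S3-p⁵∣²≤
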